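{- Let $k\in\mathbb{N}$, let $f_1,\ldots,f_k:\mathbb{N}\to\mathbb{C}$ be completely multiplicative arithmetic functions and let $F=f_1*\cdots*f_k$ (Dirichlet convolution). Let $\vartheta_F:\mathbb{N}^2\to\mathbb{C}$ be the multiplicative function of two variables defined, for every prime $p$ and every $\nu_1,\nu_2\in\mathbb{N}_0$, by \[ \vartheta_F(p^{\nu_1},p^{\nu_2})= \begin{cases} 1, & \nu_1=\nu_2=0,\\ (-1)^{\nu_1+\nu_2-1} e_{\nu_1+\nu_2}(f_1(p),\ldots,f_k(p)), & \nu_1,\nu_2\ge 1,\ \nu_1+\nu_2 \le k,\\ 0, & \text{otherwise}, \end{cases} \] where $e_d(x_1,\ldots,x_k)=\sum_{1\le i_1<\cdots<i_d\le k}x_{i_1}\cdots x_{i_d}$ is the elementary symmetric polynomial of degree $d$. Let $\vartheta_F^{ -1_*}$ be the inverse of $\vartheta_F$ under the two-variable Dirichlet convolution. Then for every $n_1,n_2\in\mathbb{N}$, \[ F(n_1n_2) = \sum_{a_1\mid n_1, \, a_2\mid n_2} F\left(\frac{n_1}{a_1}\right) F \left(\frac{n_2}{a_2}\right)\vartheta_F(a_1,a_2), \] and \[ F(n_1) F(n_2) = \sum_{a_1\mid n_1, \, a_2\mid n_2} F\left(\frac{n_1n_2}{a_1a_2}\right) \vartheta_F^{ -1_*}(a_1,a_2). \]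
   Context: $\mathbb{N}=\{1,2,\ldots\}$, $\mathbb{N}_0=\{0,1,2,\ldots\}$. For $G,H:\mathbb{N}^2\to\mathbb{C}$, the two-variable Dirichlet convolution is $(G*H)(n_1,n_2)=\sum_{a_1\mid n_1,a_2\mid n_2}G(a_1,a_2)H(n_1/a_1,n_2/a_2)$, with identity $\delta$ ($\delta(1,1)=1$, $\delta(n_1,n_2)=0$ if $n_1n_2>1$); $G$ has an inverse $G^{ -1_*}$ iff $G(1,1)\ne0$. A function $G:\mathbb{N}^2\to\mathbb{C}$ is multiplicative if it is not identically zero and $G(m_1n_1,m_2n_2)=G(m_1,m_2)G(n_1,n_2)$ whenever $\gcd(m_1m_2,n_1n_2)=1$; it then satisfies $G(n_1,n_2)=\prod_p G(p^{\nu_p(n_1)},p^{\nu_p(n_2)})$ and is determined by its values on pairs of powers of the same prime. By convention $e_0=1$ and $e_d=0$ for $d>k$. -}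

module Defs where

open import Level using (_⊔_)
open import Algebra.Bundles using (CommutativeRing)
open import Data.Nat using (ℕ; zero; suc; _≤_; _≤?_; _≟_)
import Data.Nat as N
open import Data.Nat.Coprimality using (Coprime)
open import Data.Bool using (Bool; true; false; if_then_else_)
open import Data.List using (List; []; _∷_; map; upTo; concatMap; foldr)
open import Data.Vec using (Vec; []; _∷_)
import Data.Vec as V
open import Data.Product using (_×_; _,_; ∃₂)
open import Relation.Nullary using (¬_)
open import Relation.Nullary.Decidable using (⌊_⌋)

range : ℕ → List ℕ
range n = map suc (upTo n)

divPairs : ℕ → List (ℕ × ℕ)
divPairs n = concatMap (λ a → concatMap (λ b → if ⌊ a N.* b ≟ n ⌋ then (a , b) ∷ [] else []) (range n)) (range n)

subsets : (k : ℕ) → List (Vec Bool k)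
subsets zero = [] ∷ []
subsets (suc k) = concatMap (λ s → (false ∷ s) ∷ (true ∷ s) ∷ []) (subsets k)

card : ∀ {k} → Vec Bool k → ℕ
card [] = 0
card (false ∷ s) = card s
card (true ∷ s) = suc (card s)

module WithRing {c ℓ} (R : CommutativeRing c ℓ) where
  open CommutativeRing R

  sumL : ∀ {a} {A : Set a} → (A → Carrier) → List A → Carrier
  sumL f xs = foldr (λ x acc → f x + acc) 0# xs

  prodSel : ∀ {k} → Vec Bool k → Vec Carrier k → Carrier
  prodSel [] [] = 1#
  prodSel (false ∷ s) (x ∷ xs) = prodSel s xs
  prodSel (true ∷ s) (x ∷ xs) = x * prodSel s xs

  -- elementary symmetric polynomial e_d(x_1,...,x_k) = Σ_{i_1<...<i_d} x_{i_1}⋯x_{i_d}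
  -- (e_0 = 1, e_d = 0 for d > k automatically)
  elemSym : ∀ {k} → ℕ → Vec Carrier k → Carrier
  elemSym {k} d xs = sumL (λ s → if ⌊ card s ≟ d ⌋ then prodSel s xs else 0#) (subsets k)

  negOnePow : ℕ → Carrier
  negOnePow zero = 1#
  negOnePow (suc m) = (- 1#) * negOnePow m

  _⋆_ : (ℕ → Carrier) → (ℕ → Carrier) → (ℕ → Carrier)
  (f ⋆ g) n = sumL (λ { (a , b) → f a * g b }) (divPairs n)

  δ₁ : ℕ → Carrier
  δ₁ n = if ⌊ n ≟ 1 ⌋ then 1# else 0#

  convAll : ∀ {k} → Vec (ℕ → Carrier) k → (ℕ → Carrier)
  convAll fs = V.foldr _ _⋆_ δ₁ fs

  CompletelyMultiplicative : (ℕ → Carrier) → Set ℓ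
  CompletelyMultiplicative f =
    (f 1 ≈ 1#) × (∀ m n → 1 ≤ m → 1 ≤ n → f (m N.* n) ≈ f m * f n)

  _⋆₂_ : (ℕ → ℕ → Carrier) → (ℕ → ℕ → Carrier) → (ℕ → ℕ → Carrier)
  (G ⋆₂ H) n₁ n₂ =
    sumL (λ { (a₁ , b₁) → sumL (λ { (a₂ , b₂) → G a₁ a₂ * H b₁ b₂ }) (divPairs n₂) }) (divPairs n₁)

  δ₂ : ℕ → ℕ → Carrier
  δ₂ n₁ n₂ = if ⌊ n₁ N.* n₂ ≟ 1 ⌋ then 1# else 0#

  Multiplicative₂ : (ℕ → ℕ → Carrier) → Set ℓ
  Multiplicative₂ G =
    (∃₂ λ n₁ n₂ → (1 ≤ n₁) × (1 ≤ n₂) × ¬ (G n₁ n₂ ≈ 0#)) ×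
    (∀ m₁ m₂ n₁ n₂ → 1 ≤ m₁ → 1 ≤ m₂ → 1 ≤ n₁ → 1 ≤ n₂ →
       Coprime (m₁ N.* m₂) (n₁ N.* n₂) →
       G (m₁ N.* n₁) (m₂ N.* n₂) ≈ G m₁ m₂ * G n₁ n₂)

  thetaPP : ∀ {k} → Vec (ℕ → Carrier) k → ℕ → ℕ → ℕ → Carrier
  thetaPP fs p zero zero = 1#
  thetaPP fs p zero (suc _) = 0#
  thetaPP fs p (suc _) zero = 0#
  thetaPP {k} fs p (suc a) (suc b) =
    if ⌊ suc a N.+ suc b ≤? k ⌋
    then negOnePow (suc a N.+ b) * elemSym (suc a N.+ suc b) (V.map (λ f → f p) fs)
    else 0#

  -- Σ_{a₁ b₁ = n₁, a₂ b₂ = n₂} h a₁ b₁ a₂ b₂   (i.e. Σ_{a₁∣n₁, a₂∣n₂} with b_i = n_i / a_i)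
  divSum₂ : ℕ → ℕ → (ℕ → ℕ → ℕ → ℕ → Carrier) → Carrier
  divSum₂ n₁ n₂ h =
    sumL (λ { (a₁ , b₁) → sumL (λ { (a₂ , b₂) → h a₁ b₁ a₂ b₂ }) (divPairs n₂) }) (divPairs n₁)

-- Both identities compare functions of (n₁ , n₂) that are multiplicative in the two-variable
-- sense: F is multiplicative as a convolution of completely multiplicative functions, hence so
-- are F(n₁n₂), F(n₁)F(n₂) and their convolutions with ϑ_F, and such functions are determined by
-- their values at pairs (p^a , p^b). With x_i = f_i(p), F(p^n) is the complete homogeneous
-- symmetric polynomial h_n(x), whose generating function ∏ (1 - x_i t)⁻¹ is inverse to
-- c(t) = Σ (-1)^d e_d(x) t^d. Since h(t) c(t) = 1, the product of the shifted series
-- Σₙ h_{a+n} tⁿ with c(t) has n-th coefficient Σ_{i+j=a} h_j ϑ_F(p^i , p^n); multiplying back by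
-- h(t) gives h_{a+b} = Σ ϑ_F(p^i , p^k) h_{a-i} h_{b-k}, the first identity at (p^a , p^b).
-- The second identity follows by convolving the first with ϑ_F⁻¹.

module Submission where

open import Defs
open import Algebra.Bundles using (CommutativeRing)
open import Data.Nat using (ℕ; _≤_; _^_; _*_)
open import Data.Nat.Primality using (Prime)
open import Data.Vec using (Vec)
open import Data.Vec.Relation.Unary.All using (All)
open import Data.Product using (_×_)

open import Level using (Level)
open import Function using (_∘_; mk⇔)
open import Data.Unit using (⊤; tt)
open import Data.Bool using (Bool; true; false; if_then_else_)
open import Data.Nat using (zero; suc; _<_; z≤n; s≤s; _≟_; _≤?_; >-nonZero)
import Data.Nat as ℕ
import Data.Nat.Properties as ℕₚ
import Algebra.Properties.CommutativeSemigroup ℕₚ.*-commutativeSemigroup as ℕ*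
open import Data.Nat.Divisibility
  using (_∣_; divides; _∣?_; ∣-trans; ∣-antisym; ∣1⇒≡1; m∣m*n; n∣m*n; *-pres-∣; *-cancelˡ-∣; *-monoʳ-∣; quotient-<)
open import Data.Nat.Coprimality using (Coprime; coprime-divisor)
open import Data.Nat.GCD using (gcd; gcd[m,n]∣m; gcd[m,n]∣n; gcd-greatest)
open import Data.Nat.Primality using (prime[2]; prime⇒irreducible; prime⇒nonZero; prime⇒nonTrivial; euclidsLemma)
open import Data.Nat.Primality.Factorisation using (factorise; PrimeFactorisation)
open import Data.Nat.ListAction using (product)
open import Data.Nat.Induction using (<-rec)
open import Data.Product using (_,_; proj₁; proj₂; ∃-syntax; map₁; zip′; uncurry)
import Data.Product as Product
open import Data.Sum using (inj₁; inj₂)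
open import Data.List using (List; []; _∷_; _++_; map; concatMap)
open import Data.List.Membership.Propositional using (_∈_; find; lose)
open import Data.List.Membership.Propositional.Properties using (∈-map⁺; ∈-map⁻; ∈-concatMap⁺; ∈-concatMap⁻; ∈-upTo⁺)
open import Data.List.Membership.Propositional.Properties.WithK using (unique∧set⇒bag)
open import Data.List.Relation.Unary.Any using (here; there)
import Data.List.Relation.Unary.All as ListAll
open ListAll using ([])
open import Data.List.Relation.Unary.AllPairs using ([]; _∷_)
open import Data.List.Relation.Unary.Unique.Propositional using (Unique)
import Data.List.Relation.Unary.Unique.Propositional.Properties as Unique
open import Data.List.Relation.Binary.Permutation.Propositional as ↭ using (_↭_)
open import Data.List.Relation.Binary.BagAndSetEquality using (∼bag⇒↭)
open import Data.Vec using ([]; _∷_)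
import Data.Vec as Vec
open import Data.Vec.Relation.Unary.All using ([]; _∷_)
open import Relation.Binary.Definitions using (tri<; tri≈; tri>)
open import Relation.Nullary using (yes; no; ¬_; contradiction)
open import Relation.Nullary.Decidable using (⌊_⌋)
import Relation.Binary.PropositionalEquality as ≡
open ≡ using (_≡_; _≢_)

unique-map : ∀ {a b} {A : Set a} {B : Set b} (f : A → B) {xs : List A} → Unique xs →
  (∀ {x y} → x ∈ xs → y ∈ xs → f x ≡ f y → x ≡ y) → Unique (map f xs)
unique-map f [] inj = []
unique-map f {x ∷ xs} (x∉xs ∷ xs!) inj =
  ListAll.tabulate fresh ∷ unique-map f xs! (λ x∈ y∈ → inj (there x∈) (there y∈))
  where
  fresh : ∀ {z} → z ∈ map f xs → f x ≢ z
  fresh z∈ fx≡z with _ , y∈xs , ≡.refl ← ∈-map⁻ f z∈ =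
    ListAll.lookup x∉xs y∈xs (inj (here ≡.refl) (there y∈xs) fx≡z)

unique-concatMap : ∀ {a b} {A : Set a} {B : Set b} (f : A → List B) (key : B → A) {xs : List A} → Unique xs →
  (∀ x → Unique (f x)) → (∀ {x z} → z ∈ f x → key z ≡ x) → Unique (concatMap f xs)
unique-concatMap f key [] f! keyed = []
unique-concatMap f key {x ∷ xs} (x∉xs ∷ xs!) f! keyed =
  Unique.++⁺ (f! x) (unique-concatMap f key xs! f! keyed) disjoint
  where
  disjoint : ∀ {z} → ¬ (z ∈ f x × z ∈ concatMap f xs)
  disjoint (z∈fx , z∈rest) with y , y∈xs , z∈fy ← find (∈-concatMap⁻ f z∈rest) =
    ListAll.lookup x∉xs y∈xs (≡.trans (≡.sym (keyed z∈fx)) (keyed z∈fy))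

module _ {a b} {A : Set a} {B : Set b} where

  dependentPairs : List A → (A → List B) → List (A × B)
  dependentPairs xs ys = concatMap (λ x → map (x ,_) (ys x)) xs

  ∈-dependentPairs⁺ : ∀ {xs ys x y} → x ∈ xs → y ∈ ys x → (x , y) ∈ dependentPairs xs ys
  ∈-dependentPairs⁺ x∈ y∈ = ∈-concatMap⁺ _ (lose x∈ (∈-map⁺ _ y∈))

  ∈-dependentPairs⁻ : ∀ xs ys {x y} → (x , y) ∈ dependentPairs xs ys → x ∈ xs × y ∈ ys x
  ∈-dependentPairs⁻ xs ys xy∈
    with _ , x∈ , xy∈′ ← find (∈-concatMap⁻ _ {xs = xs} xy∈)
    with _ , y∈ , ≡.refl ← ∈-map⁻ _ xy∈′ = x∈ , y∈

  dependentPairs-unique : ∀ {xs ys} → Unique xs → (∀ x → Unique (ys x)) → Unique (dependentPairs xs ys)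
  dependentPairs-unique {ys = ys} xs! ys! =
    unique-concatMap _ proj₁ xs! (λ x → Unique.map⁺ (≡.cong proj₂) (ys! x)) first
    where
    first : ∀ {x z} → z ∈ map (x ,_) (ys x) → proj₁ z ≡ x
    first z∈ with _ , _ , ≡.refl ← ∈-map⁻ _ z∈ = ≡.refl

-- Divisor pairs and antidiagonals

*-pres-1≤ : ∀ {a b} → 1 ≤ a → 1 ≤ b → 1 ≤ a * b
*-pres-1≤ = ℕₚ.*-mono-≤

1≤-*ˡ : ∀ {a b n} → a * b ≡ n → 1 ≤ n → 1 ≤ a
1≤-*ˡ {zero} ≡.refl ()
1≤-*ˡ {suc a} _ _ = s≤s z≤n

1≤-*ʳ : ∀ {a b n} → a * b ≡ n → 1 ≤ n → 1 ≤ b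
1≤-*ʳ {a} {b} ab≡n = 1≤-*ˡ (≡.trans (ℕₚ.*-comm b a) ab≡n)

*-cancelˡ-1≤ : ∀ {m a b} → 1 ≤ m → m * a ≡ m * b → a ≡ b
*-cancelˡ-1≤ {m} {a} {b} 1≤m = ℕₚ.*-cancelˡ-≡ a b m {{>-nonZero 1≤m}}

∈-range⁺ : ∀ {n x} → 1 ≤ x → x ≤ n → x ∈ range n
∈-range⁺ {x = suc x} _ x≤n = ∈-map⁺ suc (∈-upTo⁺ x≤n)

∈-range⁻ : ∀ {n x} → x ∈ range n → 1 ≤ x
∈-range⁻ x∈ with _ , _ , ≡.refl ← ∈-map⁻ suc x∈ = s≤s z≤n

range-unique : ∀ n → Unique (range n)
range-unique n = Unique.map⁺ ℕₚ.suc-injective (Unique.upTo⁺ n)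

private
  pairWithProduct : ℕ → ℕ → ℕ → List (ℕ × ℕ)
  pairWithProduct n a b = if ⌊ a * b ≟ n ⌋ then (a , b) ∷ [] else []

  ∈-pairWithProduct⁻ : ∀ {n a b z} → z ∈ pairWithProduct n a b → z ≡ (a , b) × a * b ≡ n
  ∈-pairWithProduct⁻ {n} {a} {b} z∈ with a * b ≟ n
  ∈-pairWithProduct⁻ (here z≡ab) | yes ab≡n = z≡ab , ab≡n

  ∈-pairWithProduct⁺ : ∀ {n a b} → a * b ≡ n → (a , b) ∈ pairWithProduct n a b
  ∈-pairWithProduct⁺ {n} {a} {b} ab≡n with a * b ≟ n
  ... | yes _ = here ≡.refl
  ... | no ab≢n = contradiction ab≡n ab≢n

  pairWithProduct-unique : ∀ n a b → Unique (pairWithProduct n a b)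
  pairWithProduct-unique n a b with a * b ≟ n
  ... | yes _ = [] ∷ []
  ... | no _ = []

∈-divPairs⁺ : ∀ {n a b} → a * b ≡ n → 1 ≤ n → (a , b) ∈ divPairs n
∈-divPairs⁺ {n} {a} {b} ab≡n 1≤n =
  ∈-concatMap⁺ _ (lose (∈-range⁺ 1≤a a≤n) (∈-concatMap⁺ _ (lose (∈-range⁺ 1≤b b≤n) (∈-pairWithProduct⁺ ab≡n))))
  where
  1≤a : 1 ≤ a
  1≤a = 1≤-*ˡ {a} {b} ab≡n 1≤n
  1≤b : 1 ≤ b
  1≤b = 1≤-*ʳ {a} {b} ab≡n 1≤n
  a≤n : a ≤ n
  a≤n = ≡.subst (a ≤_) ab≡n (ℕₚ.m≤m*n a b {{>-nonZero 1≤b}})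
  b≤n : b ≤ n
  b≤n = ≡.subst (b ≤_) ab≡n (ℕₚ.m≤n*m b a {{>-nonZero 1≤a}})

-- Opaque: unfolding the enumeration behind divPairs makes later unification very slow.
opaque
  ∈-divPairs⁻ : ∀ n {a b} → (a , b) ∈ divPairs n → a * b ≡ n × 1 ≤ a × 1 ≤ b
  ∈-divPairs⁻ n ab∈
    with a′ , a′∈ , ab∈′ ← find (∈-concatMap⁻ _ {xs = range n} ab∈)
    with b′ , b′∈ , ab∈″ ← find (∈-concatMap⁻ _ {xs = range n} ab∈′)
    with ≡.refl , ab≡n ← ∈-pairWithProduct⁻ ab∈″ = ab≡n , ∈-range⁻ a′∈ , ∈-range⁻ b′∈

∈-divPairs⇒∣ˡ : ∀ n {a b} → (a , b) ∈ divPairs n → a ∣ n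
∈-divPairs⇒∣ˡ n {a} {b} ab∈ = ≡.subst (a ∣_) (proj₁ (∈-divPairs⁻ n ab∈)) (m∣m*n b)

∈-divPairs⇒∣ʳ : ∀ n {a b} → (a , b) ∈ divPairs n → b ∣ n
∈-divPairs⇒∣ʳ n {a} {b} ab∈ = ≡.subst (b ∣_) (proj₁ (∈-divPairs⁻ n ab∈)) (n∣m*n a)

divPairs-unique : ∀ n → Unique (divPairs n)
divPairs-unique n =
  unique-concatMap _ proj₁ (range-unique n)
    (λ a → unique-concatMap (pairWithProduct n a) proj₂ (range-unique n) (pairWithProduct-unique n a) second)
    first
  where
  second : ∀ {a b z} → z ∈ pairWithProduct n a b → proj₂ z ≡ b
  second z∈ with ≡.refl , _ ← ∈-pairWithProduct⁻ z∈ = ≡.refl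
  first : ∀ {a z} → z ∈ concatMap (pairWithProduct n a) (range n) → proj₁ z ≡ a
  first z∈ with _ , _ , z∈′ ← find (∈-concatMap⁻ _ {xs = range n} z∈)
           with ≡.refl , _ ← ∈-pairWithProduct⁻ z∈′ = ≡.refl

antidiagonal : ℕ → List (ℕ × ℕ)
antidiagonal zero = (0 , 0) ∷ []
antidiagonal (suc n) = (0 , suc n) ∷ map (map₁ suc) (antidiagonal n)

∈-antidiagonal⁺ : ∀ {n i j} → i ℕ.+ j ≡ n → (i , j) ∈ antidiagonal n
∈-antidiagonal⁺ {zero} {zero} ≡.refl = here ≡.refl
∈-antidiagonal⁺ {suc n} {zero} ≡.refl = here ≡.refl
∈-antidiagonal⁺ {suc n} {suc i} i+j≡n = there (∈-map⁺ (map₁ suc) (∈-antidiagonal⁺ (ℕₚ.suc-injective i+j≡n)))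

∈-antidiagonal⁻ : ∀ {n i j} → (i , j) ∈ antidiagonal n → i ℕ.+ j ≡ n
∈-antidiagonal⁻ {zero} (here ≡.refl) = ≡.refl
∈-antidiagonal⁻ {suc n} (here ≡.refl) = ≡.refl
∈-antidiagonal⁻ {suc n} (there ij∈) with (i , j) , ij∈′ , ≡.refl ← ∈-map⁻ (map₁ suc) ij∈ =
  ≡.cong suc (∈-antidiagonal⁻ ij∈′)

antidiagonal-unique : ∀ n → Unique (antidiagonal n)
antidiagonal-unique zero = [] ∷ []
antidiagonal-unique (suc n) =
  ListAll.tabulate head-fresh ∷ Unique.map⁺ map₁-suc-injective (antidiagonal-unique n)
  where
  head-fresh : ∀ {z} → z ∈ map (map₁ suc) (antidiagonal n) → (0 , suc n) ≢ z
  head-fresh z∈ eq with _ , _ , ≡.refl ← ∈-map⁻ (map₁ suc) z∈ with () ← eq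
  map₁-suc-injective : ∀ {x y : ℕ × ℕ} → map₁ suc x ≡ map₁ suc y → x ≡ y
  map₁-suc-injective {i , j} {.i , .j} ≡.refl = ≡.refl

-- Divisors of coprime products and of prime powers

coprime-∣ : ∀ {m n a b} → Coprime m n → a ∣ m → b ∣ n → Coprime a b
coprime-∣ m⊥n a∣m b∣n (d∣a , d∣b) = m⊥n (∣-trans d∣a a∣m , ∣-trans d∣b b∣n)

gcd-cofactors-coprime : ∀ {a m a′ m′} → 1 ≤ gcd a m → a ≡ a′ * gcd a m → m ≡ m′ * gcd a m → Coprime a′ m′
gcd-cofactors-coprime {a} {m} {a′} {m′} 1≤g a≡a′g m≡m′g {d} (d∣a′ , d∣m′) =
  ∣1⇒≡1 (*-cancelˡ-∣ g {{>-nonZero 1≤g}} (≡.subst (g * d ∣_) (≡.sym (ℕₚ.*-identityʳ g)) gd∣g))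
  where
  g : ℕ
  g = gcd a m
  gd∣g : g * d ∣ g
  gd∣g = gcd-greatest (≡.subst (g * d ∣_) (≡.trans (ℕₚ.*-comm g a′) (≡.sym a≡a′g)) (*-monoʳ-∣ g d∣a′))
                      (≡.subst (g * d ∣_) (≡.trans (ℕₚ.*-comm g m′) (≡.sym m≡m′g)) (*-monoʳ-∣ g d∣m′))

-- The m-part of a divisor a of m * n is gcd a m.
coprime-split : ∀ {m n a b} → Coprime m n → a * b ≡ m * n → 1 ≤ a →
  ∃[ a₁ ] ∃[ b₁ ] ∃[ a₂ ] ∃[ b₂ ]
    a₁ * b₁ ≡ m × a₂ * b₂ ≡ n × a₁ * a₂ ≡ a × b₁ * b₂ ≡ b
coprime-split {m} {n} {a} {b} m⊥n ab≡mn 1≤a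
  with divides a₂ a≡a₂g ← gcd[m,n]∣m a m | divides b₁ m≡b₁g ← gcd[m,n]∣n a m =
  g , b₁ , a₂ , b₂ , gb₁≡m , a₂b₂≡n , ga₂≡a , b₁b₂≡b
  where
  open ≡.≡-Reasoning
  g : ℕ
  g = gcd a m
  ga₂≡a : g * a₂ ≡ a
  ga₂≡a = ≡.trans (ℕₚ.*-comm g a₂) (≡.sym a≡a₂g)
  gb₁≡m : g * b₁ ≡ m
  gb₁≡m = ≡.trans (ℕₚ.*-comm g b₁) (≡.sym m≡b₁g)
  1≤g : 1 ≤ g
  1≤g = 1≤-*ˡ ga₂≡a 1≤a
  a₂b≡b₁n : a₂ * b ≡ b₁ * n
  a₂b≡b₁n = *-cancelˡ-1≤ 1≤g (begin
    g * (a₂ * b) ≡⟨ ℕₚ.*-assoc g a₂ b ⟨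
    g * a₂ * b   ≡⟨ ≡.cong (_* b) ga₂≡a ⟩
    a * b        ≡⟨ ab≡mn ⟩
    m * n        ≡⟨ ≡.cong (_* n) gb₁≡m ⟨
    g * b₁ * n   ≡⟨ ℕₚ.*-assoc g b₁ n ⟩
    g * (b₁ * n) ∎)
  a₂∣n : a₂ ∣ n
  a₂∣n = coprime-divisor (gcd-cofactors-coprime {a} {m} {a₂} {b₁} 1≤g a≡a₂g m≡b₁g)
                         (divides b (≡.trans (≡.sym a₂b≡b₁n) (ℕₚ.*-comm a₂ b)))
  b₂ : ℕ
  b₂ = _∣_.quotient a₂∣n
  a₂b₂≡n : a₂ * b₂ ≡ n
  a₂b₂≡n = ≡.trans (ℕₚ.*-comm a₂ b₂) (≡.sym (_∣_.equality a₂∣n))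
  b₁b₂≡b : b₁ * b₂ ≡ b
  b₁b₂≡b = *-cancelˡ-1≤ 1≤a (begin
    a * (b₁ * b₂)        ≡⟨ ≡.cong (_* (b₁ * b₂)) ga₂≡a ⟨
    g * a₂ * (b₁ * b₂)   ≡⟨ ℕ*.interchange g a₂ b₁ b₂ ⟩
    g * b₁ * (a₂ * b₂)   ≡⟨ ≡.cong₂ _*_ gb₁≡m a₂b₂≡n ⟩
    m * n                ≡⟨ ab≡mn ⟨
    a * b                ∎)

coprime-∣-cancel : ∀ {m n a₁ a₁′ a₂ a₂′} → Coprime m n → a₁ ∣ m → a₁′ ∣ m → a₂ ∣ n → a₂′ ∣ n →
  a₁ * a₂ ≡ a₁′ * a₂′ → a₁ ≡ a₁′
coprime-∣-cancel {a₁ = a₁} {a₁′} {a₂} {a₂′} m⊥n a₁∣m a₁′∣m a₂∣n a₂′∣n eq =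
  ∣-antisym
    (coprime-divisor (coprime-∣ m⊥n a₁∣m a₂′∣n) (≡.subst (a₁ ∣_) (≡.trans eq (ℕₚ.*-comm a₁′ a₂′)) (m∣m*n a₂)))
    (coprime-divisor (coprime-∣ m⊥n a₁′∣m a₂∣n) (≡.subst (a₁′ ∣_) (≡.trans (≡.sym eq) (ℕₚ.*-comm a₁ a₂)) (m∣m*n a₂′)))

module _ {m n : ℕ} where

  private
    _·ₚ_ : ℕ × ℕ → ℕ × ℕ → ℕ × ℕ
    _·ₚ_ = zip′ _*_ _*_

  ∈-divPairs-zip : ∀ {x y} → x ∈ divPairs m → y ∈ divPairs n → x ·ₚ y ∈ divPairs (m * n)
  ∈-divPairs-zip {a₁ , b₁} {a₂ , b₂} x∈ y∈ =
    let a₁b₁≡m , 1≤a₁ , 1≤b₁ = ∈-divPairs⁻ m x∈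
        a₂b₂≡n , 1≤a₂ , 1≤b₂ = ∈-divPairs⁻ n y∈
    in ∈-divPairs⁺ (≡.trans (ℕ*.interchange a₁ a₂ b₁ b₂) (≡.cong₂ _*_ a₁b₁≡m a₂b₂≡n))
                   (≡.subst₂ (λ k l → 1 ≤ k * l) a₁b₁≡m a₂b₂≡n (*-pres-1≤ (*-pres-1≤ 1≤a₁ 1≤b₁) (*-pres-1≤ 1≤a₂ 1≤b₂)))

  divPairs-zip-injective : Coprime m n → ∀ {x y x′ y′} →
    x ∈ divPairs m → y ∈ divPairs n → x′ ∈ divPairs m → y′ ∈ divPairs n →
    x ·ₚ y ≡ x′ ·ₚ y′ → (x , y) ≡ (x′ , y′)
  divPairs-zip-injective m⊥n {a₁ , b₁} {a₂ , b₂} {a₁′ , b₁′} {a₂′ , b₂′} x∈ y∈ x′∈ y′∈ eq =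
    ≡.cong₂ _,_ (≡.cong₂ _,_ a₁≡a₁′ b₁≡b₁′) (≡.cong₂ _,_ a₂≡a₂′ b₂≡b₂′)
    where
    a₁b₁≡m : a₁ * b₁ ≡ m
    a₁b₁≡m = proj₁ (∈-divPairs⁻ m x∈)
    a₂b₂≡n : a₂ * b₂ ≡ n
    a₂b₂≡n = proj₁ (∈-divPairs⁻ n y∈)
    a₁′b₁′≡m : a₁′ * b₁′ ≡ m
    a₁′b₁′≡m = proj₁ (∈-divPairs⁻ m x′∈)
    a₂′b₂′≡n : a₂′ * b₂′ ≡ n
    a₂′b₂′≡n = proj₁ (∈-divPairs⁻ n y′∈)
    1≤a₁ : 1 ≤ a₁
    1≤a₁ = proj₁ (proj₂ (∈-divPairs⁻ m x∈))
    1≤a₂ : 1 ≤ a₂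
    1≤a₂ = proj₁ (proj₂ (∈-divPairs⁻ n y∈))
    a₁≡a₁′ : a₁ ≡ a₁′
    a₁≡a₁′ = coprime-∣-cancel m⊥n (∈-divPairs⇒∣ˡ m x∈) (∈-divPairs⇒∣ˡ m x′∈)
               (∈-divPairs⇒∣ˡ n y∈) (∈-divPairs⇒∣ˡ n y′∈) (≡.cong proj₁ eq)
    b₁≡b₁′ : b₁ ≡ b₁′
    b₁≡b₁′ = *-cancelˡ-1≤ 1≤a₁ (≡.trans a₁b₁≡m (≡.trans (≡.sym a₁′b₁′≡m) (≡.cong (_* b₁′) (≡.sym a₁≡a₁′))))
    a₂≡a₂′ : a₂ ≡ a₂′
    a₂≡a₂′ = *-cancelˡ-1≤ 1≤a₁ (≡.trans (≡.cong proj₁ eq) (≡.cong (_* a₂′) (≡.sym a₁≡a₁′)))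
    b₂≡b₂′ : b₂ ≡ b₂′
    b₂≡b₂′ = *-cancelˡ-1≤ 1≤a₂ (≡.trans a₂b₂≡n (≡.trans (≡.sym a₂′b₂′≡n) (≡.cong (_* b₂′) (≡.sym a₂≡a₂′))))

  divPairs-zip-surjective : Coprime m n → ∀ {z} → z ∈ divPairs (m * n) →
    ∃[ x ] ∃[ y ] x ∈ divPairs m × y ∈ divPairs n × x ·ₚ y ≡ z
  divPairs-zip-surjective m⊥n {a , b} z∈ =
    let ab≡mn , 1≤a , 1≤b = ∈-divPairs⁻ (m * n) z∈
        a₁ , b₁ , a₂ , b₂ , a₁b₁≡m , a₂b₂≡n , a₁a₂≡a , b₁b₂≡b = coprime-split m⊥n ab≡mn 1≤a
        1≤mn = ≡.subst (1 ≤_) ab≡mn (*-pres-1≤ 1≤a 1≤b)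
    in (a₁ , b₁) , (a₂ , b₂) ,
       ∈-divPairs⁺ a₁b₁≡m (1≤-*ˡ {m} {n} ≡.refl 1≤mn) , ∈-divPairs⁺ a₂b₂≡n (1≤-*ʳ {m} {n} ≡.refl 1≤mn) ,
       ≡.cong₂ _,_ a₁a₂≡a b₁b₂≡b

∤-prime⇒coprime : ∀ {p a} → Prime p → ¬ p ∣ a → Coprime a p
∤-prime⇒coprime pr p∤a {d} (d∣a , d∣p) with prime⇒irreducible pr d∣p
... | inj₁ d≡1 = d≡1
... | inj₂ ≡.refl = contradiction d∣a p∤a

∣-prime-power : ∀ {p} → Prime p → ∀ n {a} → a ∣ p ^ n → ∃[ j ] a ≡ p ^ j
∣-prime-power pr zero a∣1 = 0 , ∣1⇒≡1 a∣1
∣-prime-power {p} pr (suc n) {a} a∣p^1+n with p ∣? a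
... | no p∤a = ∣-prime-power pr n (coprime-divisor (∤-prime⇒coprime pr p∤a) a∣p^1+n)
... | yes (divides a′ ≡.refl)
  with j , ≡.refl ← ∣-prime-power pr n (*-cancelˡ-∣ p {{prime⇒nonZero pr}}
                      (≡.subst (_∣ p * p ^ n) (ℕₚ.*-comm a′ p) a∣p^1+n)) =
  suc j , ℕₚ.*-comm (p ^ j) p

^-injective : ∀ {p i j} → 1 < p → p ^ i ≡ p ^ j → i ≡ j
^-injective {p} {i} {j} 1<p eq with ℕₚ.<-cmp i j
... | tri< i<j _ _ = contradiction eq (ℕₚ.<⇒≢ (ℕₚ.^-monoʳ-< p 1<p i<j))
... | tri≈ _ i≡j _ = i≡j
... | tri> _ _ j<i = contradiction (≡.sym eq) (ℕₚ.<⇒≢ (ℕₚ.^-monoʳ-< p 1<p j<i))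

prime⇒1< : ∀ {p} → Prime p → 1 < p
prime⇒1< {p} pr = ℕ.nonTrivial⇒n>1 p {{prime⇒nonTrivial pr}}

1≤^ : ∀ {p} → 1 ≤ p → ∀ n → 1 ≤ p ^ n
1≤^ {p} 1≤p n = ℕₚ.m^n>0 p {{>-nonZero 1≤p}} n

module _ {p : ℕ} (pr : Prime p) {n : ℕ} where

  private
    pow² : ℕ × ℕ → ℕ × ℕ
    pow² = Product.map (p ^_) (p ^_)

  ∈-divPairs-pow : ∀ {x} → x ∈ antidiagonal n → pow² x ∈ divPairs (p ^ n)
  ∈-divPairs-pow {i , j} ij∈ =
    ∈-divPairs⁺ (≡.trans (≡.sym (ℕₚ.^-distribˡ-+-* p i j)) (≡.cong (p ^_) (∈-antidiagonal⁻ ij∈)))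
                (1≤^ (ℕₚ.<⇒≤ (prime⇒1< pr)) n)

  divPairs-pow-injective : ∀ {x y} → pow² x ≡ pow² y → x ≡ y
  divPairs-pow-injective {i , j} {i′ , j′} eq =
    ≡.cong₂ _,_ (^-injective (prime⇒1< pr) (≡.cong proj₁ eq)) (^-injective (prime⇒1< pr) (≡.cong proj₂ eq))

  divPairs-pow-surjective : ∀ {z} → z ∈ divPairs (p ^ n) → ∃[ x ] x ∈ antidiagonal n × pow² x ≡ z
  divPairs-pow-surjective {a , b} ab∈ =
    let ab≡p^n = proj₁ (∈-divPairs⁻ (p ^ n) ab∈)
        i , a≡p^i = ∣-prime-power pr n (≡.subst (a ∣_) ab≡p^n (m∣m*n b))
        j , b≡p^j = ∣-prime-power pr n (≡.subst (b ∣_) ab≡p^n (n∣m*n a))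
        p^[i+j]≡p^n = ≡.trans (ℕₚ.^-distribˡ-+-* p i j) (≡.trans (≡.sym (≡.cong₂ _*_ a≡p^i b≡p^j)) ab≡p^n)
    in (i , j) , ∈-antidiagonal⁺ (^-injective (prime⇒1< pr) p^[i+j]≡p^n) , ≡.sym (≡.cong₂ _,_ a≡p^i b≡p^j)

coprime-prime-power : ∀ {p m} → Prime p → ¬ p ∣ m → ∀ e → Coprime (p ^ e) m
coprime-prime-power {p} pr p∤m e (d∣p^e , d∣m) with ∣-prime-power pr e d∣p^e
... | zero , d≡1 = d≡1
... | suc j , ≡.refl = contradiction (∣-trans (m∣m*n (p ^ j)) d∣m) p∤m

factorOutPrime : ∀ {p} → Prime p → ∀ n → 1 ≤ n → ∃[ e ] ∃[ m ] n ≡ p ^ e * m × ¬ p ∣ m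
factorOutPrime {p} pr = <-rec _ step
  where
  step : ∀ n → (∀ {k} → k < n → 1 ≤ k → ∃[ e ] ∃[ m ] k ≡ p ^ e * m × ¬ p ∣ m) →
          1 ≤ n → ∃[ e ] ∃[ m ] n ≡ p ^ e * m × ¬ p ∣ m
  step n rec 1≤n with p ∣? n
  ... | no p∤n = 0 , n , ≡.sym (ℕₚ.+-identityʳ n) , p∤n
  ... | yes p∣n@(divides q ≡.refl)
    with e , m , ≡.refl , p∤m ← rec (quotient-< p∣n {{prime⇒nonTrivial pr}} {{>-nonZero 1≤n}}) (1≤-*ˡ ≡.refl 1≤n) =
    suc e , m , ≡.trans (ℕₚ.*-comm (p ^ e * m) p) (≡.sym (ℕₚ.*-assoc p (p ^ e) m)) , p∤m

primeDivisor : ∀ {n} → 1 < n → ∃[ p ] Prime p × p ∣ n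
primeDivisor {n} 1<n = go factors isFactorisation factorsPrime
  where
  open PrimeFactorisation (factorise n {{>-nonZero (ℕₚ.<⇒≤ 1<n)}})
  go : ∀ ps → n ≡ product ps → ListAll.All Prime ps → ∃[ p ] Prime p × p ∣ n
  go [] n≡1 _ = contradiction n≡1 (ℕₚ.>⇒≢ 1<n)
  go (p ∷ ps) n≡pps (pr ListAll.∷ _) = p , pr , ≡.subst (p ∣_) (≡.sym n≡pps) (m∣m*n (product ps))

record PrimePowerSplitting (n₁ n₂ : ℕ) : Set where
  field
    {p} : ℕ
    prime : Prime p
    e₁ e₂ m₁ m₂ : ℕ
    n₁≡ : n₁ ≡ p ^ e₁ * m₁
    n₂≡ : n₂ ≡ p ^ e₂ * m₂
    coprime : Coprime (p ^ e₁ * p ^ e₂) (m₁ * m₂)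
    smaller : m₁ * m₂ < n₁ * n₂

primePowerSplitting : ∀ {n₁ n₂} → 1 ≤ n₁ → 1 ≤ n₂ → 1 < n₁ * n₂ → PrimePowerSplitting n₁ n₂
primePowerSplitting {n₁} {n₂} 1≤n₁ 1≤n₂ 1<n₁n₂
  with p , pr , p∣n₁n₂ ← primeDivisor 1<n₁n₂
  with e₁ , m₁ , ≡.refl , p∤m₁ ← factorOutPrime pr n₁ 1≤n₁
     | e₂ , m₂ , ≡.refl , p∤m₂ ← factorOutPrime pr n₂ 1≤n₂ =
  record { prime = pr ; e₁ = e₁ ; e₂ = e₂ ; m₁ = m₁ ; m₂ = m₂ ; n₁≡ = ≡.refl ; n₂≡ = ≡.refl
         ; coprime = ≡.subst (λ k → Coprime k (m₁ * m₂)) (ℕₚ.^-distribˡ-+-* p e₁ e₂)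
                             (coprime-prime-power pr p∤m₁m₂ (e₁ ℕ.+ e₂))
         ; smaller = smaller (e₁ ℕ.+ e₂) n₁n₂≡ }
  where
  p∤m₁m₂ : ¬ p ∣ m₁ * m₂
  p∤m₁m₂ p∣m₁m₂ with euclidsLemma m₁ m₂ pr p∣m₁m₂
  ... | inj₁ p∣m₁ = p∤m₁ p∣m₁
  ... | inj₂ p∣m₂ = p∤m₂ p∣m₂
  n₁n₂≡ : p ^ e₁ * m₁ * (p ^ e₂ * m₂) ≡ p ^ (e₁ ℕ.+ e₂) * (m₁ * m₂)
  n₁n₂≡ = ≡.trans (ℕ*.interchange (p ^ e₁) m₁ (p ^ e₂) m₂)
                  (≡.cong (_* (m₁ * m₂)) (≡.sym (ℕₚ.^-distribˡ-+-* p e₁ e₂)))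
  -- p divides n₁ n₂ but not m₁ m₂, so at least one factor p was split off
  smaller : ∀ e → p ^ e₁ * m₁ * (p ^ e₂ * m₂) ≡ p ^ e * (m₁ * m₂) → m₁ * m₂ < p ^ e₁ * m₁ * (p ^ e₂ * m₂)
  smaller zero eq = contradiction (≡.subst (p ∣_) (≡.trans eq (ℕₚ.+-identityʳ (m₁ * m₂))) p∣n₁n₂) p∤m₁m₂
  smaller (suc e) eq = ≡.subst (m₁ * m₂ <_) (≡.trans (ℕₚ.*-comm (m₁ * m₂) (p ^ suc e)) (≡.sym eq))
    (ℕₚ.m<m*n (m₁ * m₂) (p ^ suc e) {{>-nonZero (1≤-*ʳ {p ^ suc e} ≡.refl (≡.subst (1 ≤_) eq (ℕₚ.<⇒≤ 1<n₁n₂)))}}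
       (ℕₚ.^-monoʳ-< p (prime⇒1< pr) {0} {suc e} (s≤s z≤n)))

module _ {c ℓ} (R : CommutativeRing c ℓ) where

  open CommutativeRing R renaming (_*_ to _·_)
  open WithRing R
  open import Relation.Binary.Reasoning.Setoid setoid
  open import Algebra.Properties.CommutativeSemigroup +-commutativeSemigroup
    using () renaming (interchange to +-interchange)
  open import Algebra.Properties.CommutativeSemigroup *-commutativeSemigroup
    using () renaming (interchange to ·-interchange; x∙yz≈y∙xz to x·yz≈y·xz)
  open import Algebra.Properties.Ring ring
    using (-0#≈0#; -‿+-comm; -‿involutive; +-inverseʳ-unique; -‿distribˡ-*; -‿distribʳ-*; -1*x≈-x)

  private
    variable
      ℓa ℓb : Level
      A : Set ℓa
      B : Set ℓb

  sum-cong-∈ : ∀ {f g : A → Carrier} xs → (∀ {x} → x ∈ xs → f x ≈ g x) → sumL f xs ≈ sumL g xs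
  sum-cong-∈ [] _ = refl
  sum-cong-∈ (x ∷ xs) f≈g = +-cong (f≈g (here ≡.refl)) (sum-cong-∈ xs (f≈g ∘ there))

  sum-cong : ∀ {f g : A → Carrier} xs → (∀ x → f x ≈ g x) → sumL f xs ≈ sumL g xs
  sum-cong xs f≈g = sum-cong-∈ xs (λ {x} _ → f≈g x)

  sum-map : ∀ (f : B → Carrier) (g : A → B) xs → sumL f (map g xs) ≡ sumL (f ∘ g) xs
  sum-map f g [] = ≡.refl
  sum-map f g (x ∷ xs) = ≡.cong (f (g x) +_) (sum-map f g xs)

  sum-++ : ∀ (f : A → Carrier) xs ys → sumL f (xs ++ ys) ≈ sumL f xs + sumL f ys
  sum-++ f [] ys = sym (+-identityˡ _)
  sum-++ f (x ∷ xs) ys = trans (+-congˡ (sum-++ f xs ys)) (sym (+-assoc _ _ _))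

  sum-concatMap : ∀ (f : B → Carrier) (g : A → List B) xs →
    sumL f (concatMap g xs) ≈ sumL (λ x → sumL f (g x)) xs
  sum-concatMap f g [] = refl
  sum-concatMap f g (x ∷ xs) = trans (sum-++ f (g x) (concatMap g xs)) (+-congˡ (sum-concatMap f g xs))

  sum-dependentPairs : ∀ (f : A × B → Carrier) xs (ys : A → List B) →
    sumL f (dependentPairs xs ys) ≈ sumL (λ x → sumL (λ y → f (x , y)) (ys x)) xs
  sum-dependentPairs f xs ys =
    trans (sum-concatMap f _ xs) (sum-cong xs (λ x → reflexive (sum-map f (x ,_) (ys x))))

  sum-zero-∈ : ∀ (f : A → Carrier) xs → (∀ {x} → x ∈ xs → f x ≈ 0#) → sumL f xs ≈ 0#
  sum-zero-∈ f [] _ = refl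
  sum-zero-∈ f (x ∷ xs) f≈0 = trans (+-cong (f≈0 (here ≡.refl)) (sum-zero-∈ f xs (f≈0 ∘ there))) (+-identityˡ 0#)

  sum-zero : ∀ (f : A → Carrier) xs → (∀ x → f x ≈ 0#) → sumL f xs ≈ 0#
  sum-zero f xs f≈0 = sum-zero-∈ f xs (λ {x} _ → f≈0 x)

  sum-+ : ∀ (f g : A → Carrier) xs → sumL (λ x → f x + g x) xs ≈ sumL f xs + sumL g xs
  sum-+ f g [] = sym (+-identityˡ 0#)
  sum-+ f g (x ∷ xs) = trans (+-congˡ (sum-+ f g xs)) (+-interchange _ _ _ _)

  *-distribˡ-sum : ∀ k (f : A → Carrier) xs → k · sumL f xs ≈ sumL (λ x → k · f x) xs
  *-distribˡ-sum k f [] = zeroʳ k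
  *-distribˡ-sum k f (x ∷ xs) = trans (distribˡ k _ _) (+-congˡ (*-distribˡ-sum k f xs))

  *-distribʳ-sum : ∀ k (f : A → Carrier) xs → sumL f xs · k ≈ sumL (λ x → f x · k) xs
  *-distribʳ-sum k f xs = trans (*-comm _ k) (trans (*-distribˡ-sum k f xs) (sum-cong xs (λ x → *-comm k (f x))))

  -‿sum : ∀ (f : A → Carrier) xs → - sumL f xs ≈ sumL (λ x → - f x) xs
  -‿sum f [] = -0#≈0#
  -‿sum f (x ∷ xs) = trans (sym (-‿+-comm _ _)) (+-congˡ (-‿sum f xs))

  sum-comm : ∀ (f : A → B → Carrier) xs ys →
    sumL (λ x → sumL (f x) ys) xs ≈ sumL (λ y → sumL (λ x → f x y) xs) ys
  sum-comm f [] ys = sym (sum-zero _ ys (λ _ → refl))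
  sum-comm f (x ∷ xs) ys = trans (+-congˡ (sum-comm f xs ys)) (sym (sum-+ (f x) _ ys))

  sum-*-sum : ∀ (u : A → Carrier) (v : B → Carrier) xs ys →
    sumL u xs · sumL v ys ≈ sumL (λ x → sumL (λ y → u x · v y) ys) xs
  sum-*-sum u v xs ys = trans (*-distribʳ-sum _ u xs) (sum-cong xs (λ x → *-distribˡ-sum (u x) v ys))

  sum²-*-sum² : ∀ {ℓc ℓd} {C : Set ℓc} {D : Set ℓd} (u : A → B → Carrier) (v : C → D → Carrier) xs ys zs ws →
    sumL (λ x → sumL (u x) ys) xs · sumL (λ z → sumL (v z) ws) zs ≈
    sumL (λ x → sumL (λ y → sumL (λ z → sumL (λ w → u x y · v z w) ws) zs) ys) xs
  sum²-*-sum² u v xs ys zs ws =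
    trans (sum-*-sum _ _ xs zs) (sum-cong xs (λ x → trans (sum-cong zs (λ z → sum-*-sum (u x) (v z) ys ws))
      (sum-comm _ zs ys)))

  sum-↭ : ∀ (f : A → Carrier) {xs ys} → xs ↭ ys → sumL f xs ≈ sumL f ys
  sum-↭ f ↭.refl = refl
  sum-↭ f (↭.prep x xs↭ys) = +-congˡ (sum-↭ f xs↭ys)
  sum-↭ f (↭.swap x y xs↭ys) =
    trans (sym (+-assoc _ _ _)) (trans (+-cong (+-comm _ _) (sum-↭ f xs↭ys)) (+-assoc _ _ _))
  sum-↭ f (↭.trans xs↭ys ys↭zs) = trans (sum-↭ f xs↭ys) (sum-↭ f ys↭zs)

  sum-reindex : ∀ (f : B → Carrier) (g : A → B) {xs ys} → Unique xs → Unique ys →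
    (∀ {x} → x ∈ xs → g x ∈ ys) →
    (∀ {y} → y ∈ ys → ∃[ x ] x ∈ xs × g x ≡ y) →
    (∀ {x x′} → x ∈ xs → x′ ∈ xs → g x ≡ g x′ → x ≡ x′) →
    sumL (f ∘ g) xs ≈ sumL f ys
  sum-reindex f g {xs} {ys} xs! ys! into onto injective = begin
    sumL (f ∘ g) xs   ≡⟨ sum-map f g xs ⟨
    sumL f (map g xs) ≈⟨ sum-↭ f (∼bag⇒↭ (unique∧set⇒bag (unique-map g xs! injective) ys! (mk⇔ to from))) ⟩
    sumL f ys         ∎
    where
    to : ∀ {y} → y ∈ map g xs → y ∈ ys
    to y∈ with _ , x∈ , ≡.refl ← ∈-map⁻ g y∈ = into x∈
    from : ∀ {y} → y ∈ ys → y ∈ map g xs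
    from y∈ with _ , x∈ , ≡.refl ← onto y∈ = ∈-map⁺ g x∈

  sum-single : ∀ (f : A → Carrier) {xs x₀} → Unique xs → x₀ ∈ xs →
    (∀ {x} → x ∈ xs → x ≢ x₀ → f x ≈ 0#) → sumL f xs ≈ f x₀
  sum-single f (x∉xs ∷ xs!) (here ≡.refl) vanish =
    trans (+-congˡ (sum-zero-∈ f _ (λ x∈ → vanish (there x∈) (ListAll.lookup x∉xs x∈ ∘ ≡.sym)))) (+-identityʳ _)
  sum-single f (x∉xs ∷ xs!) (there x₀∈) vanish =
    trans (+-cong (vanish (here ≡.refl) (ListAll.lookup x∉xs x₀∈)) (sum-single f xs! x₀∈ (vanish ∘ there)))
          (+-identityˡ _)

  module Decomposition
    (_∙_ : ℕ → ℕ → ℕ) (Admissible : ℕ → Set) (pairs : ℕ → List (ℕ × ℕ))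
    (pairs-unique : ∀ n → Unique (pairs n))
    (∈-pairs⁺ : ∀ {n a b} → a ∙ b ≡ n → Admissible a → Admissible b → (a , b) ∈ pairs n)
    (∈-pairs⁻ : ∀ n {a b} → (a , b) ∈ pairs n → a ∙ b ≡ n × Admissible a × Admissible b)
    (∙-comm : ∀ a b → a ∙ b ≡ b ∙ a)
    (∙-assoc : ∀ a b d → (a ∙ b) ∙ d ≡ a ∙ (b ∙ d))
    (∙-admissible : ∀ {a b} → Admissible a → Admissible b → Admissible (a ∙ b))
    where

    sum-swap : ∀ n (H : ℕ → ℕ → Carrier) →
      sumL (λ x → H (proj₁ x) (proj₂ x)) (pairs n) ≈ sumL (λ x → H (proj₂ x) (proj₁ x)) (pairs n)
    sum-swap n H = sym (sum-reindex _ Product.swap (pairs-unique n) (pairs-unique n) swap-∈ onto injective)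
      where
      swap-∈ : ∀ {x} → x ∈ pairs n → Product.swap x ∈ pairs n
      swap-∈ {a , b} x∈ with ab≡n , adm-a , adm-b ← ∈-pairs⁻ n x∈ = ∈-pairs⁺ (≡.trans (∙-comm b a) ab≡n) adm-b adm-a
      onto : ∀ {y} → y ∈ pairs n → ∃[ x ] x ∈ pairs n × Product.swap x ≡ y
      onto y∈ = _ , swap-∈ y∈ , ≡.refl
      injective : ∀ {x x′} → x ∈ pairs n → x′ ∈ pairs n → Product.swap x ≡ Product.swap x′ → x ≡ x′
      injective _ _ ≡.refl = ≡.refl

    private
      rightNested leftNested : ℕ → List ((ℕ × ℕ) × (ℕ × ℕ))
      rightNested n = dependentPairs (pairs n) (pairs ∘ proj₂)
      leftNested n = dependentPairs (pairs n) (pairs ∘ proj₁)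

      reassociate : (ℕ × ℕ) × (ℕ × ℕ) → (ℕ × ℕ) × (ℕ × ℕ)
      reassociate ((a , _) , (b , d)) = ((a ∙ b , d) , (a , b))

    sum-assoc : ∀ n (X : ℕ → ℕ → ℕ → Carrier) →
      sumL (λ x → sumL (λ y → X (proj₁ x) (proj₁ y) (proj₂ y)) (pairs (proj₂ x))) (pairs n)
      ≈ sumL (λ x → sumL (λ y → X (proj₁ y) (proj₂ y) (proj₂ x)) (pairs (proj₁ x))) (pairs n)
    sum-assoc n X = begin
      sumL (λ x → sumL (λ y → X (proj₁ x) (proj₁ y) (proj₂ y)) (pairs (proj₂ x))) (pairs n)
        ≈⟨ sum-dependentPairs _ (pairs n) (pairs ∘ proj₂) ⟨
      sumL (λ t → X (proj₁ (proj₁ t)) (proj₁ (proj₂ t)) (proj₂ (proj₂ t))) (rightNested n)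
        ≈⟨ sum-reindex (λ t → X (proj₁ (proj₂ t)) (proj₂ (proj₂ t)) (proj₂ (proj₁ t))) reassociate
             (dependentPairs-unique (pairs-unique n) (pairs-unique ∘ proj₂))
             (dependentPairs-unique (pairs-unique n) (pairs-unique ∘ proj₁))
             into onto injective ⟩
      sumL (λ t → X (proj₁ (proj₂ t)) (proj₂ (proj₂ t)) (proj₂ (proj₁ t))) (leftNested n)
        ≈⟨ sum-dependentPairs _ (pairs n) (pairs ∘ proj₁) ⟩
      sumL (λ x → sumL (λ y → X (proj₁ y) (proj₂ y) (proj₂ x)) (pairs (proj₁ x))) (pairs n) ∎
      where
      into : ∀ {t} → t ∈ rightNested n → reassociate t ∈ leftNested n
      into {(a , e) , (b , d)} t∈
        with ae∈ , bd∈ ← ∈-dependentPairs⁻ (pairs n) (pairs ∘ proj₂) t∈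
        with ae≡n , adm-a , _ ← ∈-pairs⁻ n ae∈ | ≡.refl , adm-b , adm-d ← ∈-pairs⁻ e bd∈ =
        ∈-dependentPairs⁺ (∈-pairs⁺ (≡.trans (∙-assoc a b d) ae≡n) (∙-admissible adm-a adm-b) adm-d)
                          (∈-pairs⁺ ≡.refl adm-a adm-b)
      onto : ∀ {t} → t ∈ leftNested n → ∃[ s ] s ∈ rightNested n × reassociate s ≡ t
      onto {(e , d) , (a , b)} t∈
        with ed∈ , ab∈ ← ∈-dependentPairs⁻ (pairs n) (pairs ∘ proj₁) t∈
        with ed≡n , _ , adm-d ← ∈-pairs⁻ n ed∈ | ≡.refl , adm-a , adm-b ← ∈-pairs⁻ e ab∈ =
        ((a , b ∙ d) , (b , d)) ,
        ∈-dependentPairs⁺ (∈-pairs⁺ (≡.trans (≡.sym (∙-assoc a b d)) ed≡n) adm-a (∙-admissible adm-b adm-d))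
                          (∈-pairs⁺ ≡.refl adm-b adm-d) ,
        ≡.refl
      injective : ∀ {s s′} → s ∈ rightNested n → s′ ∈ rightNested n → reassociate s ≡ reassociate s′ → s ≡ s′
      injective {(a , e) , (b , d)} {(a′ , e′) , (b′ , d′)} s∈ s′∈ ≡.refl
        with _ , bd∈ ← ∈-dependentPairs⁻ (pairs n) (pairs ∘ proj₂) s∈
           | _ , bd′∈ ← ∈-dependentPairs⁻ (pairs n) (pairs ∘ proj₂) s′∈
        with ≡.refl , _ ← ∈-pairs⁻ e bd∈ | ≡.refl , _ ← ∈-pairs⁻ e′ bd′∈ = ≡.refl

  module Antidiagonal = Decomposition ℕ._+_ (λ _ → ⊤) antidiagonal antidiagonal-unique
    (λ i+j≡n _ _ → ∈-antidiagonal⁺ i+j≡n) (λ _ ij∈ → ∈-antidiagonal⁻ ij∈ , tt , tt)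
    ℕₚ.+-comm ℕₚ.+-assoc (λ _ _ → tt)

  module DivisorPairs = Decomposition _*_ (1 ≤_) divPairs divPairs-unique
    (λ ab≡n 1≤a 1≤b → ∈-divPairs⁺ ab≡n (≡.subst (1 ≤_) ab≡n (*-pres-1≤ 1≤a 1≤b))) ∈-divPairs⁻
    ℕₚ.*-comm ℕₚ.*-assoc *-pres-1≤

  sum-divPairs-coprime : ∀ {m n} → Coprime m n → (H : ℕ × ℕ → Carrier) →
    sumL H (divPairs (m * n)) ≈
    sumL (λ x → sumL (λ y → H (proj₁ x * proj₁ y , proj₂ x * proj₂ y)) (divPairs n)) (divPairs m)
  sum-divPairs-coprime {m} {n} m⊥n H = begin
    sumL H (divPairs (m * n))
      ≈⟨ sum-reindex H (uncurry (zip′ _*_ _*_)) (dependentPairs-unique (divPairs-unique m) (λ _ → divPairs-unique n))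
           (divPairs-unique (m * n)) into onto injective ⟨
    sumL (H ∘ uncurry (zip′ _*_ _*_)) (dependentPairs (divPairs m) (λ _ → divPairs n))
      ≈⟨ sum-dependentPairs _ (divPairs m) (λ _ → divPairs n) ⟩
    sumL (λ x → sumL (λ y → H (proj₁ x * proj₁ y , proj₂ x * proj₂ y)) (divPairs n)) (divPairs m) ∎
    where
    pairs : List ((ℕ × ℕ) × (ℕ × ℕ))
    pairs = dependentPairs (divPairs m) (λ _ → divPairs n)
    into : ∀ {t} → t ∈ pairs → uncurry (zip′ _*_ _*_) t ∈ divPairs (m * n)
    into t∈ = let x∈ , y∈ = ∈-dependentPairs⁻ (divPairs m) (λ _ → divPairs n) t∈ in ∈-divPairs-zip {m} {n} x∈ y∈
    onto : ∀ {z} → z ∈ divPairs (m * n) → ∃[ t ] t ∈ pairs × uncurry (zip′ _*_ _*_) t ≡ z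
    onto z∈ = let x , y , x∈ , y∈ , eq = divPairs-zip-surjective m⊥n z∈ in (x , y) , ∈-dependentPairs⁺ x∈ y∈ , eq
    injective : ∀ {t t′} → t ∈ pairs → t′ ∈ pairs → uncurry (zip′ _*_ _*_) t ≡ uncurry (zip′ _*_ _*_) t′ → t ≡ t′
    injective t∈ t′∈ = let x∈ , y∈ = ∈-dependentPairs⁻ (divPairs m) (λ _ → divPairs n) t∈
                           x′∈ , y′∈ = ∈-dependentPairs⁻ (divPairs m) (λ _ → divPairs n) t′∈
                       in divPairs-zip-injective m⊥n x∈ y∈ x′∈ y′∈

  sum-divPairs-pow : ∀ {p} → Prime p → ∀ n (H : ℕ × ℕ → Carrier) →
    sumL H (divPairs (p ^ n)) ≈ sumL (λ x → H (p ^ proj₁ x , p ^ proj₂ x)) (antidiagonal n)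
  sum-divPairs-pow {p} pr n H =
    sym (sum-reindex H (Product.map (p ^_) (p ^_)) (antidiagonal-unique n) (divPairs-unique (p ^ n))
           (∈-divPairs-pow pr {n}) (divPairs-pow-surjective pr {n}) (λ _ _ → divPairs-pow-injective pr {n}))

  -- Multiplicative functions

  MultiplicativeLaw : (ℕ → Carrier) → Set ℓ
  MultiplicativeLaw f = ∀ m n → 1 ≤ m → 1 ≤ n → Coprime m n → f (m * n) ≈ f m · f n

  MultiplicativeLaw₂ : (ℕ → ℕ → Carrier) → Set ℓ
  MultiplicativeLaw₂ G = ∀ m₁ m₂ n₁ n₂ → 1 ≤ m₁ → 1 ≤ m₂ → 1 ≤ n₁ → 1 ≤ n₂ →
    Coprime (m₁ * m₂) (n₁ * n₂) → G (m₁ * n₁) (m₂ * n₂) ≈ G m₁ m₂ · G n₁ n₂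

  δ₁-multiplicative : MultiplicativeLaw δ₁
  δ₁-multiplicative m n _ _ _ with m * n ≟ 1 | m ≟ 1 | n ≟ 1
  ... | yes _ | yes _ | yes _ = sym (*-identityˡ 1#)
  ... | yes mn≡1 | no m≢1 | _ = contradiction (ℕₚ.m*n≡1⇒m≡1 m n mn≡1) m≢1
  ... | yes mn≡1 | yes _ | no n≢1 = contradiction (ℕₚ.m*n≡1⇒n≡1 m n mn≡1) n≢1
  ... | no mn≢1 | yes ≡.refl | yes ≡.refl = contradiction ≡.refl mn≢1
  ... | no _ | no _ | _ = sym (zeroˡ _)
  ... | no _ | yes _ | no _ = sym (zeroʳ _)

  ⋆-multiplicative : ∀ {f g} → MultiplicativeLaw f → MultiplicativeLaw g → MultiplicativeLaw (f ⋆ g)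
  ⋆-multiplicative {f} {g} f-mult g-mult m n _ _ m⊥n = begin
    (f ⋆ g) (m * n)
      ≈⟨ sum-divPairs-coprime m⊥n _ ⟩
    sumL (λ x → sumL (λ y → f (proj₁ x * proj₁ y) · g (proj₂ x * proj₂ y)) (divPairs n)) (divPairs m)
      ≈⟨ sum-cong-∈ (divPairs m) (λ x∈ → sum-cong-∈ (divPairs n) (λ y∈ → splitTerm x∈ y∈)) ⟩
    sumL (λ x → sumL (λ y → (f (proj₁ x) · g (proj₂ x)) · (f (proj₁ y) · g (proj₂ y))) (divPairs n)) (divPairs m)
      ≈⟨ sum-*-sum _ _ (divPairs m) (divPairs n) ⟨
    (f ⋆ g) m · (f ⋆ g) n ∎
    where
    splitTerm : ∀ {a₁ b₁ a₂ b₂} → (a₁ , b₁) ∈ divPairs m → (a₂ , b₂) ∈ divPairs n →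
      f (a₁ * a₂) · g (b₁ * b₂) ≈ (f a₁ · g b₁) · (f a₂ · g b₂)
    splitTerm x∈ y∈ =
      let _ , 1≤a₁ , 1≤b₁ = ∈-divPairs⁻ m x∈
          _ , 1≤a₂ , 1≤b₂ = ∈-divPairs⁻ n y∈
      in trans (*-cong (f-mult _ _ 1≤a₁ 1≤a₂ (coprime-∣ m⊥n (∈-divPairs⇒∣ˡ m x∈) (∈-divPairs⇒∣ˡ n y∈)))
                       (g-mult _ _ 1≤b₁ 1≤b₂ (coprime-∣ m⊥n (∈-divPairs⇒∣ʳ m x∈) (∈-divPairs⇒∣ʳ n y∈))))
               (·-interchange _ _ _ _)

  convAll-multiplicative : ∀ {k} (fs : Vec (ℕ → Carrier) k) → All CompletelyMultiplicative fs →
    MultiplicativeLaw (convAll fs)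
  convAll-multiplicative [] [] = δ₁-multiplicative
  convAll-multiplicative (f ∷ fs) ((_ , f-mult) ∷ fs-mult) =
    ⋆-multiplicative (λ m n 1≤m 1≤n _ → f-mult m n 1≤m 1≤n) (convAll-multiplicative fs fs-mult)

  ⋆₂-multiplicative : ∀ {G H} → MultiplicativeLaw₂ G → MultiplicativeLaw₂ H → MultiplicativeLaw₂ (G ⋆₂ H)
  ⋆₂-multiplicative {G} {H} G-mult H-mult m₁ m₂ n₁ n₂ _ _ _ _ m⊥n = begin
    (G ⋆₂ H) (m₁ * n₁) (m₂ * n₂)
      ≈⟨ sum-divPairs-coprime m₁⊥n₁ _ ⟩
    sumL (λ x → sumL (λ x′ → sumL (λ y → term (proj₁ x * proj₁ x′ , proj₂ x * proj₂ x′) y)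
      (divPairs (m₂ * n₂))) (divPairs n₁)) (divPairs m₁)
      ≈⟨ sum-cong (divPairs m₁) (λ x → sum-cong (divPairs n₁) (λ x′ → sum-divPairs-coprime m₂⊥n₂ _)) ⟩
    sumL (λ x → sumL (λ x′ → sumL (λ y → sumL (λ y′ → term (proj₁ x * proj₁ x′ , proj₂ x * proj₂ x′)
      (proj₁ y * proj₁ y′ , proj₂ y * proj₂ y′)) (divPairs n₂)) (divPairs m₂)) (divPairs n₁)) (divPairs m₁)
      ≈⟨ sum-cong-∈ (divPairs m₁) (λ x∈ → sum-cong-∈ (divPairs n₁) (λ x′∈ →
           sum-cong-∈ (divPairs m₂) (λ y∈ → sum-cong-∈ (divPairs n₂) (λ y′∈ → splitTerm x∈ x′∈ y∈ y′∈)))) ⟩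
    sumL (λ x → sumL (λ x′ → sumL (λ y → sumL (λ y′ → term x y · term x′ y′) (divPairs n₂)) (divPairs m₂))
      (divPairs n₁)) (divPairs m₁)
      ≈⟨ sum-cong (divPairs m₁) (λ x → sum-comm _ (divPairs n₁) (divPairs m₂)) ⟩
    sumL (λ x → sumL (λ y → sumL (λ x′ → sumL (λ y′ → term x y · term x′ y′) (divPairs n₂)) (divPairs n₁))
      (divPairs m₂)) (divPairs m₁)
      ≈⟨ sum²-*-sum² term term (divPairs m₁) (divPairs m₂) (divPairs n₁) (divPairs n₂) ⟨
    (G ⋆₂ H) m₁ m₂ · (G ⋆₂ H) n₁ n₂ ∎
    where
    term : ℕ × ℕ → ℕ × ℕ → Carrier
    term x y = G (proj₁ x) (proj₁ y) · H (proj₂ x) (proj₂ y)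
    m₁⊥n₁ : Coprime m₁ n₁
    m₁⊥n₁ = coprime-∣ m⊥n (m∣m*n m₂) (m∣m*n n₂)
    m₂⊥n₂ : Coprime m₂ n₂
    m₂⊥n₂ = coprime-∣ m⊥n (n∣m*n m₁) (n∣m*n n₁)
    splitTerm : ∀ {x x′ y y′} → x ∈ divPairs m₁ → x′ ∈ divPairs n₁ → y ∈ divPairs m₂ → y′ ∈ divPairs n₂ →
      term (proj₁ x * proj₁ x′ , proj₂ x * proj₂ x′) (proj₁ y * proj₁ y′ , proj₂ y * proj₂ y′)
      ≈ term x y · term x′ y′
    splitTerm x∈ x′∈ y∈ y′∈ =
      let _ , 1≤a₁ , 1≤b₁ = ∈-divPairs⁻ m₁ x∈
          _ , 1≤a₁′ , 1≤b₁′ = ∈-divPairs⁻ n₁ x′∈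
          _ , 1≤a₂ , 1≤b₂ = ∈-divPairs⁻ m₂ y∈
          _ , 1≤a₂′ , 1≤b₂′ = ∈-divPairs⁻ n₂ y′∈
      in trans (*-cong (G-mult _ _ _ _ 1≤a₁ 1≤a₂ 1≤a₁′ 1≤a₂′
                          (coprime-∣ m⊥n (*-pres-∣ (∈-divPairs⇒∣ˡ m₁ x∈) (∈-divPairs⇒∣ˡ m₂ y∈))
                                         (*-pres-∣ (∈-divPairs⇒∣ˡ n₁ x′∈) (∈-divPairs⇒∣ˡ n₂ y′∈))))
                       (H-mult _ _ _ _ 1≤b₁ 1≤b₂ 1≤b₁′ 1≤b₂′
                          (coprime-∣ m⊥n (*-pres-∣ (∈-divPairs⇒∣ʳ m₁ x∈) (∈-divPairs⇒∣ʳ m₂ y∈))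
                                         (*-pres-∣ (∈-divPairs⇒∣ʳ n₁ x′∈) (∈-divPairs⇒∣ʳ n₂ y′∈)))))
               (·-interchange _ _ _ _)

  atProduct : (ℕ → Carrier) → ℕ → ℕ → Carrier
  atProduct F n₁ n₂ = F (n₁ * n₂)

  valueProduct : (ℕ → Carrier) → ℕ → ℕ → Carrier
  valueProduct F n₁ n₂ = F n₁ · F n₂

  atProduct-multiplicative : ∀ {F} → MultiplicativeLaw F → MultiplicativeLaw₂ (atProduct F)
  atProduct-multiplicative {F} F-mult m₁ m₂ n₁ n₂ 1≤m₁ 1≤m₂ 1≤n₁ 1≤n₂ m⊥n =
    trans (reflexive (≡.cong F (ℕ*.interchange m₁ n₁ m₂ n₂)))
          (F-mult (m₁ * m₂) (n₁ * n₂) (*-pres-1≤ 1≤m₁ 1≤m₂) (*-pres-1≤ 1≤n₁ 1≤n₂) m⊥n)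

  valueProduct-multiplicative : ∀ {F} → MultiplicativeLaw F → MultiplicativeLaw₂ (valueProduct F)
  valueProduct-multiplicative F-mult m₁ m₂ n₁ n₂ 1≤m₁ 1≤m₂ 1≤n₁ 1≤n₂ m⊥n =
    trans (*-cong (F-mult m₁ n₁ 1≤m₁ 1≤n₁ (coprime-∣ m⊥n (m∣m*n m₂) (m∣m*n n₂)))
                  (F-mult m₂ n₂ 1≤m₂ 1≤n₂ (coprime-∣ m⊥n (n∣m*n m₁) (n∣m*n n₁))))
          (·-interchange _ _ _ _)

  multiplicative₂-unique : ∀ {G H} → MultiplicativeLaw₂ G → MultiplicativeLaw₂ H →
    (∀ p → Prime p → ∀ i j → G (p ^ i) (p ^ j) ≈ H (p ^ i) (p ^ j)) →
    ∀ n₁ n₂ → 1 ≤ n₁ → 1 ≤ n₂ → G n₁ n₂ ≈ H n₁ n₂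
  multiplicative₂-unique {G} {H} G-mult H-mult agree n₁ n₂ = <-rec Agree step (n₁ * n₂) n₁ n₂ ≡.refl
    where
    Agree : ℕ → Set ℓ
    Agree N = ∀ n₁ n₂ → n₁ * n₂ ≡ N → 1 ≤ n₁ → 1 ≤ n₂ → G n₁ n₂ ≈ H n₁ n₂
    step : ∀ N → (∀ {M} → M < N → Agree M) → Agree N
    step _ rec n₁ n₂ ≡.refl 1≤n₁ 1≤n₂ with n₁ * n₂ ≟ 1
    -- the only such pair is (1 , 1) = (2 ^ 0 , 2 ^ 0)
    ... | yes n₁n₂≡1 rewrite ℕₚ.m*n≡1⇒m≡1 n₁ n₂ n₁n₂≡1 | ℕₚ.m*n≡1⇒n≡1 n₁ n₂ n₁n₂≡1 = agree 2 prime[2] 0 0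
    ... | no n₁n₂≢1 = begin
      G n₁ n₂                         ≡⟨ ≡.cong₂ G n₁≡ n₂≡ ⟩
      G (p ^ e₁ * m₁) (p ^ e₂ * m₂)   ≈⟨ G-mult _ _ _ _ (1≤^ 1≤p e₁) (1≤^ 1≤p e₂) 1≤m₁ 1≤m₂ coprime ⟩
      G (p ^ e₁) (p ^ e₂) · G m₁ m₂   ≈⟨ *-cong (agree p prime e₁ e₂) (rec smaller m₁ m₂ ≡.refl 1≤m₁ 1≤m₂) ⟩
      H (p ^ e₁) (p ^ e₂) · H m₁ m₂   ≈⟨ H-mult _ _ _ _ (1≤^ 1≤p e₁) (1≤^ 1≤p e₂) 1≤m₁ 1≤m₂ coprime ⟨
      H (p ^ e₁ * m₁) (p ^ e₂ * m₂)   ≡⟨ ≡.cong₂ H n₁≡ n₂≡ ⟨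
      H n₁ n₂                         ∎
      where
      open PrimePowerSplitting (primePowerSplitting 1≤n₁ 1≤n₂ (ℕₚ.≤∧≢⇒< (*-pres-1≤ 1≤n₁ 1≤n₂) (n₁n₂≢1 ∘ ≡.sym)))
      1≤p : 1 ≤ p
      1≤p = ℕₚ.<⇒≤ (prime⇒1< prime)
      1≤m₁ : 1 ≤ m₁
      1≤m₁ = 1≤-*ʳ {p ^ e₁} (≡.sym n₁≡) 1≤n₁
      1≤m₂ : 1 ≤ m₂
      1≤m₂ = 1≤-*ʳ {p ^ e₂} (≡.sym n₂≡) 1≤n₂

  infix 4 _≈₊_
  _≈₊_ : (ℕ → ℕ → Carrier) → (ℕ → ℕ → Carrier) → Set ℓ
  G ≈₊ H = ∀ n₁ n₂ → 1 ≤ n₁ → 1 ≤ n₂ → G n₁ n₂ ≈ H n₁ n₂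

  ≈₊-refl : ∀ {G} → G ≈₊ G
  ≈₊-refl _ _ _ _ = refl

  ⋆₂-cong : ∀ {G G′ H H′} → G ≈₊ G′ → H ≈₊ H′ → ∀ n₁ n₂ → (G ⋆₂ H) n₁ n₂ ≈ (G′ ⋆₂ H′) n₁ n₂
  ⋆₂-cong G≈G′ H≈H′ n₁ n₂ = sum-cong-∈ (divPairs n₁) (λ x∈ → sum-cong-∈ (divPairs n₂) (λ y∈ →
    let _ , 1≤a₁ , 1≤b₁ = ∈-divPairs⁻ n₁ x∈
        _ , 1≤a₂ , 1≤b₂ = ∈-divPairs⁻ n₂ y∈
    in *-cong (G≈G′ _ _ 1≤a₁ 1≤a₂) (H≈H′ _ _ 1≤b₁ 1≤b₂)))

  ⋆₂-comm : ∀ G H n₁ n₂ → (G ⋆₂ H) n₁ n₂ ≈ (H ⋆₂ G) n₁ n₂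
  ⋆₂-comm G H n₁ n₂ = begin
    (G ⋆₂ H) n₁ n₂
      ≈⟨ DivisorPairs.sum-swap n₁ (λ a₁ b₁ → sumL (λ y → G a₁ (proj₁ y) · H b₁ (proj₂ y)) (divPairs n₂)) ⟩
    sumL (λ x → sumL (λ y → G (proj₂ x) (proj₁ y) · H (proj₁ x) (proj₂ y)) (divPairs n₂)) (divPairs n₁)
      ≈⟨ sum-cong (divPairs n₁) (λ x → DivisorPairs.sum-swap n₂ (λ a₂ b₂ → G (proj₂ x) a₂ · H (proj₁ x) b₂)) ⟩
    sumL (λ x → sumL (λ y → G (proj₂ x) (proj₂ y) · H (proj₁ x) (proj₁ y)) (divPairs n₂)) (divPairs n₁)
      ≈⟨ sum-cong (divPairs n₁) (λ x → sum-cong (divPairs n₂) (λ y → *-comm _ _)) ⟩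
    (H ⋆₂ G) n₁ n₂ ∎

  δ₂-vanishˡ : ∀ {a₁} a₂ → a₁ ≢ 1 → δ₂ a₁ a₂ ≈ 0#
  δ₂-vanishˡ {a₁} a₂ a₁≢1 with a₁ * a₂ ≟ 1
  ... | yes a₁a₂≡1 = contradiction (ℕₚ.m*n≡1⇒m≡1 a₁ a₂ a₁a₂≡1) a₁≢1
  ... | no _ = refl

  δ₂-vanishʳ : ∀ a₁ {a₂} → a₂ ≢ 1 → δ₂ a₁ a₂ ≈ 0#
  δ₂-vanishʳ a₁ {a₂} a₂≢1 with a₁ * a₂ ≟ 1
  ... | yes a₁a₂≡1 = contradiction (ℕₚ.m*n≡1⇒n≡1 a₁ a₂ a₁a₂≡1) a₂≢1
  ... | no _ = refl

  δ₂-identityˡ : ∀ Q → δ₂ ⋆₂ Q ≈₊ Q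
  δ₂-identityˡ Q n₁ n₂ 1≤n₁ 1≤n₂ = begin
    (δ₂ ⋆₂ Q) n₁ n₂
      ≈⟨ sum-single _ (divPairs-unique n₁) (∈-divPairs⁺ (ℕₚ.*-identityˡ n₁) 1≤n₁) (λ x∈ x≢ →
           sum-zero _ (divPairs n₂) (λ y → trans (*-congʳ (δ₂-vanishˡ _ (off-unit x∈ x≢))) (zeroˡ _))) ⟩
    sumL (λ y → δ₂ 1 (proj₁ y) · Q n₁ (proj₂ y)) (divPairs n₂)
      ≈⟨ sum-single _ (divPairs-unique n₂) (∈-divPairs⁺ (ℕₚ.*-identityˡ n₂) 1≤n₂) (λ y∈ y≢ →
           trans (*-congʳ (δ₂-vanishʳ 1 (off-unit y∈ y≢))) (zeroˡ _)) ⟩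
    1# · Q n₁ n₂
      ≈⟨ *-identityˡ _ ⟩
    Q n₁ n₂ ∎
    where
    off-unit : ∀ {n a b} → (a , b) ∈ divPairs n → (a , b) ≢ (1 , n) → a ≢ 1
    off-unit {n} ab∈ ab≢ ≡.refl = ab≢ (≡.cong (1 ,_) (≡.trans (≡.sym (ℕₚ.*-identityˡ _)) (proj₁ (∈-divPairs⁻ n ab∈))))

  ⋆₂-assoc : ∀ G H K n₁ n₂ → (G ⋆₂ (H ⋆₂ K)) n₁ n₂ ≈ ((G ⋆₂ H) ⋆₂ K) n₁ n₂
  ⋆₂-assoc G H K n₁ n₂ = begin
    (G ⋆₂ (H ⋆₂ K)) n₁ n₂
      ≈⟨ sum-cong (divPairs n₁) (λ x → sum-cong (divPairs n₂) (λ y →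
           trans (*-distribˡ-sum _ _ (divPairs (proj₂ x)))
                 (sum-cong (divPairs (proj₂ x)) (λ u → *-distribˡ-sum _ _ (divPairs (proj₂ y)))))) ⟩
    sumL (λ x → sumL (λ y → sumL (λ u → sumL (λ v →
      G (proj₁ x) (proj₁ y) · (H (proj₁ u) (proj₁ v) · K (proj₂ u) (proj₂ v)))
      (divPairs (proj₂ y))) (divPairs (proj₂ x))) (divPairs n₂)) (divPairs n₁)
      ≈⟨ sum-cong (divPairs n₁) (λ x → sum-comm _ (divPairs n₂) (divPairs (proj₂ x))) ⟩
    sumL (λ x → sumL (λ u → sumL (λ y → sumL (λ v →
      G (proj₁ x) (proj₁ y) · (H (proj₁ u) (proj₁ v) · K (proj₂ u) (proj₂ v)))
      (divPairs (proj₂ y))) (divPairs n₂)) (divPairs (proj₂ x))) (divPairs n₁)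
      ≈⟨ DivisorPairs.sum-assoc n₁ (λ a b d → sumL (λ y → sumL (λ v →
           G a (proj₁ y) · (H b (proj₁ v) · K d (proj₂ v))) (divPairs (proj₂ y))) (divPairs n₂)) ⟩
    sumL (λ x → sumL (λ u → sumL (λ y → sumL (λ v →
      G (proj₁ u) (proj₁ y) · (H (proj₂ u) (proj₁ v) · K (proj₂ x) (proj₂ v)))
      (divPairs (proj₂ y))) (divPairs n₂)) (divPairs (proj₁ x))) (divPairs n₁)
      ≈⟨ sum-cong (divPairs n₁) (λ x → sum-cong (divPairs (proj₁ x)) (λ u →
           DivisorPairs.sum-assoc n₂ (λ a b d → G (proj₁ u) a · (H (proj₂ u) b · K (proj₂ x) d)))) ⟩
    sumL (λ x → sumL (λ u → sumL (λ y → sumL (λ v →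
      G (proj₁ u) (proj₁ v) · (H (proj₂ u) (proj₂ v) · K (proj₂ x) (proj₂ y)))
      (divPairs (proj₁ y))) (divPairs n₂)) (divPairs (proj₁ x))) (divPairs n₁)
      ≈⟨ sum-cong (divPairs n₁) (λ x → sum-comm _ (divPairs (proj₁ x)) (divPairs n₂)) ⟩
    sumL (λ x → sumL (λ y → sumL (λ u → sumL (λ v →
      G (proj₁ u) (proj₁ v) · (H (proj₂ u) (proj₂ v) · K (proj₂ x) (proj₂ y)))
      (divPairs (proj₁ y))) (divPairs (proj₁ x))) (divPairs n₂)) (divPairs n₁)
      ≈⟨ sum-cong (divPairs n₁) (λ x → sum-cong (divPairs n₂) (λ y →
           trans (*-distribʳ-sum _ _ (divPairs (proj₁ x))) (sum-cong (divPairs (proj₁ x)) (λ u →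
             trans (*-distribʳ-sum _ _ (divPairs (proj₁ y)))
                   (sum-cong (divPairs (proj₁ y)) (λ v → *-assoc _ _ _)))))) ⟨
    ((G ⋆₂ H) ⋆₂ K) n₁ n₂ ∎

  -- Sequences as formal power series

  Seq : Set c
  Seq = ℕ → Carrier

  infix 4 _≐_
  _≐_ : Seq → Seq → Set ℓ
  u ≐ v = ∀ n → u n ≈ v n

  ≐-refl : ∀ {u} → u ≐ u
  ≐-refl _ = refl

  ≐-trans : ∀ {u v w} → u ≐ v → v ≐ w → u ≐ w
  ≐-trans u≐v v≐w n = trans (u≐v n) (v≐w n)

  infixl 7 _⊙_
  _⊙_ : Seq → Seq → Seq
  (u ⊙ v) n = sumL (λ x → u (proj₁ x) · v (proj₂ x)) (antidiagonal n)

  δ : Seq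
  δ zero = 1#
  δ (suc _) = 0#

  shift : ℕ → Seq → Seq
  shift k u n = u (k ℕ.+ n)

  sum-antidiagonal-suc : ∀ n (F : ℕ × ℕ → Carrier) →
    sumL F (antidiagonal (suc n)) ≈ F (0 , suc n) + sumL (λ x → F (suc (proj₁ x) , proj₂ x)) (antidiagonal n)
  sum-antidiagonal-suc n F = +-congˡ (reflexive (sum-map F (map₁ suc) (antidiagonal n)))

  sum-antidiagonal-head : ∀ n (F : ℕ × ℕ → Carrier) → (∀ i j → F (suc i , j) ≈ 0#) →
    sumL F (antidiagonal n) ≈ F (0 , n)
  sum-antidiagonal-head zero F _ = +-identityʳ _
  sum-antidiagonal-head (suc n) F tail≈0 =
    trans (sum-antidiagonal-suc n F)
          (trans (+-congˡ (sum-zero _ (antidiagonal n) (λ x → tail≈0 _ _))) (+-identityʳ _))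

  ⊙-cong : ∀ {u u′ v v′} → u ≐ u′ → v ≐ v′ → u ⊙ v ≐ u′ ⊙ v′
  ⊙-cong u≐u′ v≐v′ n = sum-cong (antidiagonal n) (λ x → *-cong (u≐u′ _) (v≐v′ _))

  ⊙-comm : ∀ u v → u ⊙ v ≐ v ⊙ u
  ⊙-comm u v n = trans (Antidiagonal.sum-swap n (λ i j → u i · v j)) (sum-cong (antidiagonal n) (λ x → *-comm _ _))

  ⊙-assoc : ∀ u v w → (u ⊙ v) ⊙ w ≐ u ⊙ (v ⊙ w)
  ⊙-assoc u v w n = begin
    ((u ⊙ v) ⊙ w) n
      ≈⟨ sum-cong (antidiagonal n) (λ x → *-distribʳ-sum (w (proj₂ x)) _ (antidiagonal (proj₁ x))) ⟩
    sumL (λ x → sumL (λ y → (u (proj₁ y) · v (proj₂ y)) · w (proj₂ x)) (antidiagonal (proj₁ x))) (antidiagonal n)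
      ≈⟨ Antidiagonal.sum-assoc n (λ i j k → (u i · v j) · w k) ⟨
    sumL (λ x → sumL (λ y → (u (proj₁ x) · v (proj₁ y)) · w (proj₂ y)) (antidiagonal (proj₂ x))) (antidiagonal n)
      ≈⟨ sum-cong (antidiagonal n) (λ x → trans (sum-cong (antidiagonal (proj₂ x)) (λ y → *-assoc _ _ _))
                                                (sym (*-distribˡ-sum (u (proj₁ x)) _ (antidiagonal (proj₂ x))))) ⟩
    (u ⊙ (v ⊙ w)) n ∎

  δ-identityˡ : ∀ v → δ ⊙ v ≐ v
  δ-identityˡ v n = trans (sum-antidiagonal-head n _ (λ _ _ → zeroˡ _)) (*-identityˡ _)

  δ-identityʳ : ∀ v → v ⊙ δ ≐ v
  δ-identityʳ v = ≐-trans (⊙-comm v δ) (δ-identityˡ v)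

  ⊙-cancelʳ : ∀ {u v c h} → c ⊙ h ≐ δ → u ⊙ c ≐ v ⊙ c → u ≐ v
  ⊙-cancelʳ {u} {v} {c} {h} c⊙h≐δ u⊙c≐v⊙c n = begin
    u n               ≈⟨ δ-identityʳ u n ⟨
    (u ⊙ δ) n         ≈⟨ ⊙-cong ≐-refl c⊙h≐δ n ⟨
    (u ⊙ (c ⊙ h)) n   ≈⟨ ⊙-assoc u c h n ⟨
    ((u ⊙ c) ⊙ h) n   ≈⟨ ⊙-cong u⊙c≐v⊙c ≐-refl n ⟩
    ((v ⊙ c) ⊙ h) n   ≈⟨ ⊙-assoc v c h n ⟩
    (v ⊙ (c ⊙ h)) n   ≈⟨ ⊙-cong ≐-refl c⊙h≐δ n ⟩
    (v ⊙ δ) n         ≈⟨ δ-identityʳ v n ⟩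
    v n               ∎

  ⊙-distribʳ-sum : ∀ (xs : List A) (α : A → Carrier) (W : A → Seq) v →
    (λ k → sumL (λ x → α x · W x k) xs) ⊙ v ≐ (λ n → sumL (λ x → α x · (W x ⊙ v) n) xs)
  ⊙-distribʳ-sum xs α W v n = begin
    sumL (λ y → sumL (λ x → α x · W x (proj₁ y)) xs · v (proj₂ y)) (antidiagonal n)
      ≈⟨ sum-cong (antidiagonal n) (λ y → *-distribʳ-sum _ _ xs) ⟩
    sumL (λ y → sumL (λ x → (α x · W x (proj₁ y)) · v (proj₂ y)) xs) (antidiagonal n)
      ≈⟨ sum-comm _ (antidiagonal n) xs ⟩
    sumL (λ x → sumL (λ y → (α x · W x (proj₁ y)) · v (proj₂ y)) (antidiagonal n)) xs
      ≈⟨ sum-cong xs (λ x → trans (sum-cong (antidiagonal n) (λ y → *-assoc _ _ _))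
                                  (sym (*-distribˡ-sum (α x) _ (antidiagonal n)))) ⟩
    sumL (λ x → α x · (W x ⊙ v) n) xs ∎

  ⊙-split : ∀ m u v n →
    (u ⊙ v) (suc m ℕ.+ n) ≈
    sumL (λ x → u (proj₁ x) · v (suc (proj₂ x) ℕ.+ n)) (antidiagonal m) + (shift (suc m) u ⊙ v) n
  ⊙-split zero u v n = trans (sum-antidiagonal-suc n _) (+-congʳ (sym (+-identityʳ _)))
  ⊙-split (suc m) u v n = begin
    (u ⊙ v) (suc (suc m) ℕ.+ n)
      ≈⟨ sum-antidiagonal-suc (suc m ℕ.+ n) _ ⟩
    u 0 · v (suc (suc m) ℕ.+ n) + (shift 1 u ⊙ v) (suc m ℕ.+ n)
      ≈⟨ +-congˡ (⊙-split m (shift 1 u) v n) ⟩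
    u 0 · v (suc (suc m) ℕ.+ n) + (sumL (λ x → u (suc (proj₁ x)) · v (suc (proj₂ x) ℕ.+ n)) (antidiagonal m)
                                   + (shift (suc (suc m)) u ⊙ v) n)
      ≈⟨ +-assoc _ _ _ ⟨
    (u 0 · v (suc (suc m) ℕ.+ n) + sumL (λ x → u (suc (proj₁ x)) · v (suc (proj₂ x) ℕ.+ n)) (antidiagonal m))
      + (shift (suc (suc m)) u ⊙ v) n
      ≈⟨ +-congʳ (sum-antidiagonal-suc m (λ x → u (proj₁ x) · v (suc (proj₂ x) ℕ.+ n))) ⟨
    sumL (λ x → u (proj₁ x) · v (suc (proj₂ x) ℕ.+ n)) (antidiagonal (suc m)) + (shift (suc (suc m)) u ⊙ v) n ∎

  twoVarCoeff : Seq → ℕ → ℕ → Carrier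
  twoVarCoeff c zero zero = 1#
  twoVarCoeff c zero (suc _) = 0#
  twoVarCoeff c (suc _) zero = 0#
  twoVarCoeff c (suc i) (suc j) = - c (suc i ℕ.+ suc j)

  module _ {h c : Seq} (c⊙h≐δ : c ⊙ h ≐ δ) (c₀≈1 : c 0 ≈ 1#) where

    private
      T : ℕ → ℕ → Carrier
      T = twoVarCoeff c

      h⊙c≐δ : h ⊙ c ≐ δ
      h⊙c≐δ = ≐-trans (⊙-comm h c) c⊙h≐δ

    shift-⊙-inverse : ∀ a n → (shift a h ⊙ c) n ≈ sumL (λ x → h (proj₂ x) · T (proj₁ x) n) (antidiagonal a)
    shift-⊙-inverse a zero = begin
      (shift a h ⊙ c) 0 ≈⟨ +-identityʳ _ ⟩
      h (a ℕ.+ 0) · c 0 ≈⟨ *-cong (reflexive (≡.cong h (ℕₚ.+-identityʳ a))) c₀≈1 ⟩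
      h a · 1#          ≈⟨ sum-antidiagonal-head a _ (λ i j → zeroʳ _) ⟨
      sumL (λ x → h (proj₂ x) · T (proj₁ x) 0) (antidiagonal a) ∎
    shift-⊙-inverse zero (suc n) = trans (h⊙c≐δ (suc n)) (sym (trans (+-identityʳ _) (zeroʳ _)))
    -- (h ⊙ c) (a + 1 + n + 1) = 0 splits into S and the shifted product.
    shift-⊙-inverse (suc a) (suc n) = begin
      (shift (suc a) h ⊙ c) (suc n)
        ≈⟨ +-inverseʳ-unique S _ (trans (sym (⊙-split a h c (suc n))) (h⊙c≐δ (suc a ℕ.+ suc n))) ⟩
      - S
        ≈⟨ -‿cong (Antidiagonal.sum-swap a (λ i j → h i · c (suc j ℕ.+ suc n))) ⟩
      - sumL (λ x → h (proj₂ x) · c (suc (proj₁ x) ℕ.+ suc n)) (antidiagonal a)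
        ≈⟨ -‿sum _ (antidiagonal a) ⟩
      sumL (λ x → - (h (proj₂ x) · c (suc (proj₁ x) ℕ.+ suc n))) (antidiagonal a)
        ≈⟨ sum-cong (antidiagonal a) (λ x → -‿distribʳ-* _ _) ⟩
      sumL (λ x → h (proj₂ x) · T (suc (proj₁ x)) (suc n)) (antidiagonal a)
        ≈⟨ +-identityˡ _ ⟨
      0# + sumL (λ x → h (proj₂ x) · T (suc (proj₁ x)) (suc n)) (antidiagonal a)
        ≈⟨ +-congʳ (zeroʳ _) ⟨
      h (suc a) · T 0 (suc n) + sumL (λ x → h (proj₂ x) · T (suc (proj₁ x)) (suc n)) (antidiagonal a)
        ≈⟨ sum-antidiagonal-suc a _ ⟨
      sumL (λ x → h (proj₂ x) · T (proj₁ x) (suc n)) (antidiagonal (suc a)) ∎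
      where
      S : Carrier
      S = sumL (λ x → h (proj₁ x) · c (suc (proj₂ x) ℕ.+ suc n)) (antidiagonal a)

    shift-expansion : ∀ a → shift a h ≐ (λ b → sumL (λ x → h (proj₂ x) · (T (proj₁ x) ⊙ h) b) (antidiagonal a))
    shift-expansion a = ⊙-cancelʳ c⊙h≐δ λ n → begin
      (shift a h ⊙ c) n
        ≈⟨ shift-⊙-inverse a n ⟩
      sumL (λ x → h (proj₂ x) · T (proj₁ x) n) (antidiagonal a)
        ≈⟨ sum-cong (antidiagonal a) (λ x → *-congˡ (⊙-inverse-cancel (T (proj₁ x)) n)) ⟨
      sumL (λ x → h (proj₂ x) · ((T (proj₁ x) ⊙ h) ⊙ c) n) (antidiagonal a)
        ≈⟨ ⊙-distribʳ-sum (antidiagonal a) (h ∘ proj₂) (λ x → T (proj₁ x) ⊙ h) c n ⟨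
      ((λ b → sumL (λ x → h (proj₂ x) · (T (proj₁ x) ⊙ h) b) (antidiagonal a)) ⊙ c) n ∎
      where
      ⊙-inverse-cancel : ∀ u → (u ⊙ h) ⊙ c ≐ u
      ⊙-inverse-cancel u = ≐-trans (⊙-assoc u h c) (≐-trans (⊙-cong ≐-refl h⊙c≐δ) (δ-identityʳ u))

    twoVariable-expansion : ∀ a b → h (a ℕ.+ b) ≈
      sumL (λ x → sumL (λ y → T (proj₁ x) (proj₁ y) · (h (proj₂ x) · h (proj₂ y))) (antidiagonal b)) (antidiagonal a)
    twoVariable-expansion a b = trans (shift-expansion a b) (sum-cong (antidiagonal a) λ x →
      trans (*-distribˡ-sum _ _ (antidiagonal b)) (sum-cong (antidiagonal b) λ y → x·yz≈y·xz _ _ _))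

  -- Symmetric functions and F at prime powers

  valuesAt : ∀ {k} → Vec (ℕ → Carrier) k → ℕ → Vec Carrier k
  valuesAt fs p = Vec.map (λ f → f p) fs

  geometric : Carrier → Seq
  geometric x zero = 1#
  geometric x (suc n) = x · geometric x n

  completeHomogeneous : ∀ {k} → Vec Carrier k → Seq
  completeHomogeneous [] = δ
  completeHomogeneous (x ∷ xs) = geometric x ⊙ completeHomogeneous xs

  signedElementary : ∀ {k} → Vec Carrier k → Seq
  signedElementary xs d = negOnePow d · elemSym d xs

  oneMinus : Carrier → Seq
  oneMinus x zero = 1#
  oneMinus x (suc zero) = - x
  oneMinus x (suc (suc _)) = 0#

  private
    card≤length : ∀ {k} (s : Vec Bool k) → card s ≤ k
    card≤length [] = z≤n
    card≤length (false ∷ s) = ℕₚ.m≤n⇒m≤1+n (card≤length s)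
    card≤length (true ∷ s) = s≤s (card≤length s)

    ⌊suc≟suc⌋ : ∀ m n → ⌊ suc m ≟ suc n ⌋ ≡ ⌊ m ≟ n ⌋
    ⌊suc≟suc⌋ m n with m ≟ n | suc m ≟ suc n
    ... | yes _ | yes _ = ≡.refl
    ... | no _ | no _ = ≡.refl
    ... | yes m≡n | no 1+m≢1+n = contradiction (≡.cong suc m≡n) 1+m≢1+n
    ... | no m≢n | yes 1+m≡1+n = contradiction (ℕₚ.suc-injective 1+m≡1+n) m≢n

    ·-if : ∀ b x y → x · (if b then y else 0#) ≈ (if b then x · y else 0#)
    ·-if true x y = refl
    ·-if false x y = zeroʳ x

  elemSym-cons : ∀ {k} x (xs : Vec Carrier k) d → elemSym d (x ∷ xs) ≈
    elemSym d xs + sumL (λ s → if ⌊ suc (card s) ≟ d ⌋ then x · prodSel s xs else 0#) (subsets k)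
  elemSym-cons {k} x xs d =
    trans (sum-concatMap _ _ (subsets k))
          (trans (sum-cong (subsets k) (λ s → +-congˡ (+-identityʳ _))) (sum-+ _ _ (subsets k)))

  elemSym-cons-zero : ∀ {k} x (xs : Vec Carrier k) → elemSym 0 (x ∷ xs) ≈ elemSym 0 xs
  elemSym-cons-zero {k} x xs =
    trans (elemSym-cons x xs 0) (trans (+-congˡ (sum-zero _ (subsets k) (λ _ → refl))) (+-identityʳ _))

  elemSym-cons-suc : ∀ {k} x (xs : Vec Carrier k) d → elemSym (suc d) (x ∷ xs) ≈ elemSym (suc d) xs + x · elemSym d xs
  elemSym-cons-suc {k} x xs d = trans (elemSym-cons x xs (suc d)) (+-congˡ (begin
    sumL (λ s → if ⌊ suc (card s) ≟ suc d ⌋ then x · prodSel s xs else 0#) (subsets k)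
      ≈⟨ sum-cong (subsets k) (λ s →
           reflexive (≡.cong (λ b → if b then x · prodSel s xs else 0#) (⌊suc≟suc⌋ (card s) d))) ⟩
    sumL (λ s → if ⌊ card s ≟ d ⌋ then x · prodSel s xs else 0#) (subsets k)
      ≈⟨ sum-cong (subsets k) (λ s → ·-if _ x _) ⟨
    sumL (λ s → x · (if ⌊ card s ≟ d ⌋ then prodSel s xs else 0#)) (subsets k)
      ≈⟨ *-distribˡ-sum x _ (subsets k) ⟨
    x · elemSym d xs ∎))

  elemSym-zero : ∀ {k} (xs : Vec Carrier k) → elemSym 0 xs ≈ 1#
  elemSym-zero [] = +-identityʳ 1#
  elemSym-zero (x ∷ xs) = trans (elemSym-cons-zero x xs) (elemSym-zero xs)

  elemSym-vanish : ∀ {k} (xs : Vec Carrier k) d → k < d → elemSym d xs ≈ 0#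
  elemSym-vanish {k} xs d k<d = sum-zero _ (subsets k) vanish
    where
    vanish : ∀ s → (if ⌊ card s ≟ d ⌋ then prodSel s xs else 0#) ≈ 0#
    vanish s with card s ≟ d
    ... | yes card≡d = contradiction card≡d (ℕₚ.<⇒≢ (ℕₚ.≤-<-trans (card≤length s) k<d))
    ... | no _ = refl

  oneMinus-⊙-zero : ∀ x u → (oneMinus x ⊙ u) 0 ≈ u 0
  oneMinus-⊙-zero x u = trans (+-identityʳ _) (*-identityˡ _)

  oneMinus-⊙-suc : ∀ x u n → (oneMinus x ⊙ u) (suc n) ≈ u (suc n) + - x · u n
  oneMinus-⊙-suc x u n = trans (sum-antidiagonal-suc n _)
    (+-cong (*-identityˡ _) (sum-antidiagonal-head n _ (λ _ _ → zeroˡ _)))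

  oneMinus-⊙-geometric : ∀ x → oneMinus x ⊙ geometric x ≐ δ
  oneMinus-⊙-geometric x zero = oneMinus-⊙-zero x (geometric x)
  oneMinus-⊙-geometric x (suc n) = begin
    (oneMinus x ⊙ geometric x) (suc n)    ≈⟨ oneMinus-⊙-suc x (geometric x) n ⟩
    x · geometric x n + - x · geometric x n ≈⟨ distribʳ _ x (- x) ⟨
    (x + - x) · geometric x n              ≈⟨ *-congʳ (-‿inverseʳ x) ⟩
    0# · geometric x n                     ≈⟨ zeroˡ _ ⟩
    0#                                     ∎

  signedElementary-zero : ∀ {k} (xs : Vec Carrier k) → signedElementary xs 0 ≈ 1#
  signedElementary-zero xs = trans (*-identityˡ _) (elemSym-zero xs)

  signedElementary-[] : signedElementary [] ≐ δ
  signedElementary-[] zero = trans (*-identityˡ _) (+-identityʳ 1#)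
  signedElementary-[] (suc d) = trans (*-congˡ (+-identityʳ 0#)) (zeroʳ _)

  signedElementary-∷ : ∀ {k} x (xs : Vec Carrier k) → signedElementary (x ∷ xs) ≐ oneMinus x ⊙ signedElementary xs
  signedElementary-∷ x xs zero =
    trans (*-congˡ (elemSym-cons-zero x xs)) (sym (oneMinus-⊙-zero x (signedElementary xs)))
  signedElementary-∷ x xs (suc n) = begin
    negOnePow (suc n) · elemSym (suc n) (x ∷ xs)
      ≈⟨ *-congˡ (elemSym-cons-suc x xs n) ⟩
    negOnePow (suc n) · (elemSym (suc n) xs + x · elemSym n xs)
      ≈⟨ distribˡ _ _ _ ⟩
    signedElementary xs (suc n) + (- 1# · negOnePow n) · (x · elemSym n xs)
      ≈⟨ +-congˡ (begin
           (- 1# · negOnePow n) · (x · elemSym n xs) ≈⟨ *-assoc _ _ _ ⟩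
           - 1# · (negOnePow n · (x · elemSym n xs)) ≈⟨ *-congˡ (x·yz≈y·xz _ _ _) ⟩
           - 1# · (x · signedElementary xs n)        ≈⟨ *-assoc _ _ _ ⟨
           (- 1# · x) · signedElementary xs n        ≈⟨ *-congʳ (-1*x≈-x x) ⟩
           - x · signedElementary xs n               ∎) ⟩
    signedElementary xs (suc n) + - x · signedElementary xs n
      ≈⟨ oneMinus-⊙-suc x _ n ⟨
    (oneMinus x ⊙ signedElementary xs) (suc n) ∎

  signedElementary-⊙-completeHomogeneous : ∀ {k} (xs : Vec Carrier k) →
    signedElementary xs ⊙ completeHomogeneous xs ≐ δ
  signedElementary-⊙-completeHomogeneous [] = ≐-trans (⊙-cong signedElementary-[] ≐-refl) (δ-identityˡ δ)
  signedElementary-⊙-completeHomogeneous (x ∷ xs) n = begin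
    (E′ ⊙ (g ⊙ H)) n                ≈⟨ ⊙-cong (signedElementary-∷ x xs) ≐-refl n ⟩
    ((oneMinus x ⊙ E) ⊙ (g ⊙ H)) n  ≈⟨ ⊙-assoc (oneMinus x) E (g ⊙ H) n ⟩
    (oneMinus x ⊙ (E ⊙ (g ⊙ H))) n  ≈⟨ ⊙-cong ≐-refl (⊙-assoc E g H) n ⟨
    (oneMinus x ⊙ ((E ⊙ g) ⊙ H)) n  ≈⟨ ⊙-cong ≐-refl (⊙-cong (⊙-comm E g) ≐-refl) n ⟩
    (oneMinus x ⊙ ((g ⊙ E) ⊙ H)) n  ≈⟨ ⊙-cong ≐-refl (⊙-assoc g E H) n ⟩
    (oneMinus x ⊙ (g ⊙ (E ⊙ H))) n  ≈⟨ ⊙-cong ≐-refl (⊙-cong ≐-refl (signedElementary-⊙-completeHomogeneous xs)) n ⟩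
    (oneMinus x ⊙ (g ⊙ δ)) n        ≈⟨ ⊙-cong ≐-refl (δ-identityʳ g) n ⟩
    (oneMinus x ⊙ g) n              ≈⟨ oneMinus-⊙-geometric x n ⟩
    δ n                             ∎
    where
    E′ E g H : Seq
    E′ = signedElementary (x ∷ xs)
    E = signedElementary xs
    g = geometric x
    H = completeHomogeneous xs

  completelyMultiplicative-pow : ∀ {f} → CompletelyMultiplicative f → ∀ {p} → 1 ≤ p → ∀ j →
    f (p ^ j) ≈ geometric (f p) j
  completelyMultiplicative-pow (f1≈1 , _) _ zero = f1≈1
  completelyMultiplicative-pow f-cm@(_ , f-mult) {p} 1≤p (suc j) =
    trans (f-mult p (p ^ j) 1≤p (1≤^ 1≤p j)) (*-congˡ (completelyMultiplicative-pow f-cm 1≤p j))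

  δ₁-pow : ∀ {p} → Prime p → ∀ n → δ₁ (p ^ n) ≈ δ n
  δ₁-pow pr zero = refl
  δ₁-pow {p} pr (suc n) with p ^ suc n ≟ 1
  ... | yes p^1+n≡1 = contradiction (ℕₚ.m*n≡1⇒m≡1 p (p ^ n) p^1+n≡1) (ℕₚ.>⇒≢ (prime⇒1< pr))
  ... | no _ = refl

  convAll-pow : ∀ {k} (fs : Vec (ℕ → Carrier) k) → All CompletelyMultiplicative fs → ∀ {p} → Prime p → ∀ n →
    convAll fs (p ^ n) ≈ completeHomogeneous (valuesAt fs p) n
  convAll-pow [] [] pr n = δ₁-pow pr n
  convAll-pow (f ∷ fs) (f-cm ∷ fs-cm) {p} pr n = begin
    (f ⋆ convAll fs) (p ^ n)
      ≈⟨ sum-divPairs-pow pr n _ ⟩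
    sumL (λ x → f (p ^ proj₁ x) · convAll fs (p ^ proj₂ x)) (antidiagonal n)
      ≈⟨ sum-cong (antidiagonal n) (λ x → *-cong (completelyMultiplicative-pow f-cm (ℕₚ.<⇒≤ (prime⇒1< pr)) (proj₁ x))
                                                  (convAll-pow fs fs-cm pr (proj₂ x))) ⟩
    (geometric (f p) ⊙ completeHomogeneous (valuesAt fs p)) n ∎

  thetaPP≈twoVarCoeff : ∀ {k} (fs : Vec (ℕ → Carrier) k) p i j →
    thetaPP fs p i j ≈ twoVarCoeff (signedElementary (valuesAt fs p)) i j
  thetaPP≈twoVarCoeff fs p zero zero = refl
  thetaPP≈twoVarCoeff fs p zero (suc j) = refl
  thetaPP≈twoVarCoeff fs p (suc i) zero = refl
  thetaPP≈twoVarCoeff {k} fs p (suc i) (suc j) with suc i ℕ.+ suc j ≤? k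
  ... | yes _ = sym (begin
    - (negOnePow (suc i ℕ.+ suc j) · e)       ≡⟨ ≡.cong (λ m → - (negOnePow m · e)) (ℕₚ.+-suc (suc i) j) ⟩
    - ((- 1# · negOnePow (suc i ℕ.+ j)) · e)  ≈⟨ -‿cong (*-congʳ (-1*x≈-x _)) ⟩
    - (- negOnePow (suc i ℕ.+ j) · e)         ≈⟨ -‿cong (-‿distribˡ-* _ _) ⟨
    - - (negOnePow (suc i ℕ.+ j) · e)         ≈⟨ -‿involutive _ ⟩
    negOnePow (suc i ℕ.+ j) · e               ∎)
    where
    e : Carrier
    e = elemSym (suc i ℕ.+ suc j) (valuesAt fs p)
  ... | no i+j≰k = sym (trans (-‿cong (trans (*-congˡ (elemSym-vanish _ _ (ℕₚ.≰⇒> i+j≰k))) (zeroʳ _))) -0#≈0#)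

  ⋆₂≈divSum₂ : ∀ G H n₁ n₂ → (G ⋆₂ H) n₁ n₂ ≈ divSum₂ n₁ n₂ (λ a₁ b₁ a₂ b₂ → H b₁ b₂ · G a₁ a₂)
  ⋆₂≈divSum₂ G H n₁ n₂ = sum-cong (divPairs n₁) (λ _ → sum-cong (divPairs n₂) (λ _ → *-comm _ _))

  module _ {k} (fs : Vec (ℕ → Carrier) k) (fs-cm : All CompletelyMultiplicative fs)
    {ϑ : ℕ → ℕ → Carrier} (ϑ-mult : MultiplicativeLaw₂ ϑ)
    (ϑ-pp : ∀ p → Prime p → ∀ ν₁ ν₂ → ϑ (p ^ ν₁) (p ^ ν₂) ≈ thetaPP fs p ν₁ ν₂) where

    private
      F : ℕ → Carrier
      F = convAll fs

      F-mult : MultiplicativeLaw F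
      F-mult = convAll-multiplicative fs fs-cm

    atProduct≈ϑ⋆₂valueProduct : atProduct F ≈₊ ϑ ⋆₂ valueProduct F
    atProduct≈ϑ⋆₂valueProduct = multiplicative₂-unique (atProduct-multiplicative F-mult)
      (⋆₂-multiplicative ϑ-mult (valueProduct-multiplicative F-mult)) agreeOnPrimePowers
      where
      agreeOnPrimePowers : ∀ p → Prime p → ∀ a b → F (p ^ a * p ^ b) ≈ (ϑ ⋆₂ valueProduct F) (p ^ a) (p ^ b)
      agreeOnPrimePowers p pr a b = begin
        F (p ^ a * p ^ b)
          ≡⟨ ≡.cong F (ℕₚ.^-distribˡ-+-* p a b) ⟨
        F (p ^ (a ℕ.+ b))
          ≈⟨ convAll-pow fs fs-cm pr (a ℕ.+ b) ⟩
        h (a ℕ.+ b)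
          ≈⟨ twoVariable-expansion (signedElementary-⊙-completeHomogeneous xs) (signedElementary-zero xs) a b ⟩
        sumL (λ x → sumL (λ y → T (proj₁ x) (proj₁ y) · (h (proj₂ x) · h (proj₂ y)))
          (antidiagonal b)) (antidiagonal a)
          ≈⟨ sum-cong (antidiagonal a) (λ x → sum-cong (antidiagonal b) (λ y →
               *-cong (trans (ϑ-pp p pr (proj₁ x) (proj₁ y)) (thetaPP≈twoVarCoeff fs p (proj₁ x) (proj₁ y)))
                      (*-cong (convAll-pow fs fs-cm pr (proj₂ x)) (convAll-pow fs fs-cm pr (proj₂ y))))) ⟨
        sumL (λ x → sumL (λ y → ϑ (p ^ proj₁ x) (p ^ proj₁ y) · (F (p ^ proj₂ x) · F (p ^ proj₂ y)))
          (antidiagonal b)) (antidiagonal a)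
          ≈⟨ sum-cong (antidiagonal a) (λ x → sum-divPairs-pow pr b _) ⟨
        sumL (λ x → sumL (λ y → ϑ (p ^ proj₁ x) (proj₁ y) · (F (p ^ proj₂ x) · F (proj₂ y)))
          (divPairs (p ^ b))) (antidiagonal a)
          ≈⟨ sum-divPairs-pow pr a _ ⟨
        (ϑ ⋆₂ valueProduct F) (p ^ a) (p ^ b) ∎
        where
        xs : Vec Carrier k
        xs = valuesAt fs p
        h : Seq
        h = completeHomogeneous xs
        T : ℕ → ℕ → Carrier
        T = twoVarCoeff (signedElementary xs)

    valueProduct≈ϑinv⋆₂atProduct : ∀ {ϑinv} → ϑ ⋆₂ ϑinv ≈₊ δ₂ → valueProduct F ≈₊ ϑinv ⋆₂ atProduct F
    valueProduct≈ϑinv⋆₂atProduct {ϑinv} ϑ⋆₂ϑinv≈δ₂ n₁ n₂ 1≤n₁ 1≤n₂ = begin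
      valueProduct F n₁ n₂
        ≈⟨ δ₂-identityˡ (valueProduct F) n₁ n₂ 1≤n₁ 1≤n₂ ⟨
      (δ₂ ⋆₂ valueProduct F) n₁ n₂
        ≈⟨ ⋆₂-cong (λ a₁ a₂ 1≤a₁ 1≤a₂ → sym (ϑ⋆₂ϑinv≈δ₂ a₁ a₂ 1≤a₁ 1≤a₂)) ≈₊-refl n₁ n₂ ⟩
      ((ϑ ⋆₂ ϑinv) ⋆₂ valueProduct F) n₁ n₂
        ≈⟨ ⋆₂-cong (λ a₁ a₂ _ _ → ⋆₂-comm ϑ ϑinv a₁ a₂) ≈₊-refl n₁ n₂ ⟩
      ((ϑinv ⋆₂ ϑ) ⋆₂ valueProduct F) n₁ n₂
        ≈⟨ ⋆₂-assoc ϑinv ϑ (valueProduct F) n₁ n₂ ⟨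
      (ϑinv ⋆₂ (ϑ ⋆₂ valueProduct F)) n₁ n₂
        ≈⟨ ⋆₂-cong ≈₊-refl (λ a₁ a₂ 1≤a₁ 1≤a₂ → sym (atProduct≈ϑ⋆₂valueProduct a₁ a₂ 1≤a₁ 1≤a₂)) n₁ n₂ ⟩
      (ϑinv ⋆₂ atProduct F) n₁ n₂
        ∎

theorem2 : ∀ {c ℓ} (R : CommutativeRing c ℓ) →
    let open CommutativeRing R renaming (_*_ to _·_) in
    let open WithRing R in
    (k : ℕ) → 1 ≤ k →
    (fs : Vec (ℕ → Carrier) k) → All CompletelyMultiplicative fs →
    (ϑ : ℕ → ℕ → Carrier) → Multiplicative₂ ϑ →
    (∀ p → Prime p → ∀ ν₁ ν₂ → ϑ (p ^ ν₁) (p ^ ν₂) ≈ thetaPP fs p ν₁ ν₂) →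
    (ϑinv : ℕ → ℕ → Carrier) →
    (∀ n₁ n₂ → 1 ≤ n₁ → 1 ≤ n₂ → (ϑ ⋆₂ ϑinv) n₁ n₂ ≈ δ₂ n₁ n₂) →
    ∀ n₁ n₂ → 1 ≤ n₁ → 1 ≤ n₂ →
      (convAll fs (n₁ * n₂) ≈
        divSum₂ n₁ n₂ (λ a₁ b₁ a₂ b₂ → (convAll fs b₁ · convAll fs b₂) · ϑ a₁ a₂))
      ×
      (convAll fs n₁ · convAll fs n₂ ≈
        divSum₂ n₁ n₂ (λ a₁ b₁ a₂ b₂ → convAll fs (b₁ * b₂) · ϑinv a₁ a₂))
theorem2 R _ _ fs fs-cm ϑ (_ , ϑ-mult) ϑ-pp ϑinv ϑ⋆₂ϑinv≈δ₂ n₁ n₂ 1≤n₁ 1≤n₂ =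
  trans (atProduct≈ϑ⋆₂valueProduct R fs fs-cm ϑ-mult ϑ-pp n₁ n₂ 1≤n₁ 1≤n₂) (⋆₂≈divSum₂ R ϑ _ n₁ n₂) ,
  trans (valueProduct≈ϑinv⋆₂atProduct R fs fs-cm ϑ-mult ϑ-pp ϑ⋆₂ϑinv≈δ₂ n₁ n₂ 1≤n₁ 1≤n₂) (⋆₂≈divSum₂ R ϑinv _ n₁ n₂)
  where open CommutativeRing R using (trans)
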